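{- Let $n>r>k\geq 2$ be integers, let $1/n<\delta<1$ and let $G$ be a $k$-uniform hypergraph on $n$ vertices with $\delta_{k-1}(G)\geq (1-\delta)n$. Then $$\Big(1-\binom rk\delta\Big)\binom nr\leq k_r\leq \binom nr\leq \frac{n^r}{r!},$$ and, for every edge $e\in E(G)$, $$k_{r-k}-\frac{2k\delta n^{r-k}}{(r-k)!}\binom{r}{k-1}\leq \kappa^{(r)}_e\leq k_{r-k}.$$
   Context: For a $k$-uniform hypergraph $G$ and an integer $j\ge 0$, a $j$-clique is a $j$-subset $S\subseteq V(G)$ all of whose $k$-subsets are edges of $G$ (so every $j$-subset is a $j$-clique when $j<k$); $k_j$ denotes the number of $j$-cliques of $G$, and $k_j:=0$ for $j<0$. For an edge $e$, $\kappa^{(r)}_e$ is the number of $r$-cliques containing the vertex set of $e$. $\delta_{k-1}(G)$ is the minimum, over all $(k-1)$-subsets $S$ of $V(G)$, of the number of edges containing $S$.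
   Formalization: The parameter δ takes only rational values. -}

module Defs where

open import Data.Bool using (Bool; true; false; _∧_; if_then_else_)
open import Data.Nat using (ℕ; zero; suc; _∸_; _≡ᵇ_; _!)
open import Data.Nat.Properties using (_!≢0)
open import Data.Integer using (+_)
open import Data.Rational using (ℚ; _/_)
open import Data.List using (List; []; _∷_; _++_; map; filterᵇ; length)
open import Data.Bool.ListAction using (and)
open import Data.Vec using (Vec; []; _∷_)
open import Data.Fin.Subset using (Subset; inside; outside; ∣_∣)
open import Relation.Binary.PropositionalEquality using (_≡_)

record Hypergraph (k n : ℕ) : Set where
  field
    isEdge  : Subset n → Bool
    uniform : ∀ (s : Subset n) → isEdge s ≡ true → ∣ s ∣ ≡ k
open Hypergraph public

allSubsets : (n : ℕ) → List (Subset n)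
allSubsets zero    = [] ∷ []
allSubsets (suc n) = map (outside ∷_) (allSubsets n) ++ map (inside ∷_) (allSubsets n)

_⊆ᵇ_ : ∀ {n} → Subset n → Subset n → Bool
[]          ⊆ᵇ []          = true
(outside ∷ s) ⊆ᵇ (_ ∷ t)   = s ⊆ᵇ t
(inside ∷ s)  ⊆ᵇ (inside ∷ t)  = s ⊆ᵇ t
(inside ∷ s)  ⊆ᵇ (outside ∷ t) = false

isClique : ∀ {k n} → Hypergraph k n → ℕ → Subset n → Bool
isClique {k} {n} G j S =
  (∣ S ∣ ≡ᵇ j) ∧
  and (map (λ T → if (∣ T ∣ ≡ᵇ k) ∧ (T ⊆ᵇ S) then isEdge G T else true) (allSubsets n))

cliqueCount : ∀ {k n} → Hypergraph k n → ℕ → ℕ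
cliqueCount {k} {n} G j = length (filterᵇ (λ S → isClique G j S) (allSubsets n))

cliquesContaining : ∀ {k n} → Hypergraph k n → ℕ → Subset n → ℕ
cliquesContaining {k} {n} G r e =
  length (filterᵇ (λ S → isClique G r S ∧ (e ⊆ᵇ S)) (allSubsets n))

codegree : ∀ {k n} → Hypergraph k n → Subset n → ℕ
codegree {k} {n} G S =
  length (filterᵇ (λ T → isEdge G T ∧ (S ⊆ᵇ T)) (allSubsets n))

ℕ→ℚ : ℕ → ℚ
ℕ→ℚ a = (+ a) / 1

_/!_ : ℕ → ℕ → ℚ
a /! m = _/_ (+ a) (m !) {{m !≢0}}

-- An r-set that is not a clique contains a non-edge.  Every (k-1)-set lies in at most δn non-edges,
-- so there are at most δn·C(n,k-1)/k non-edges, each inside C(n-k,r-k) r-sets; double counting turns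
-- this into at most δ·C(r,k)·C(n,r) non-cliques of size r.
--
-- For an edge e, an (r-k)-clique T fails to extend e to an r-clique only if T meets e, or some
-- non-edge inside T ∪ e meets both T and e ("T is spoilt").  At most k·C(n-1,m-1) m-sets meet e.
-- Deleting a point from a spoilt m-set either leaves it spoilt or the offending non-edge passes
-- through that point, so the number s(m) of spoilt m-sets obeys
-- m·s(m) ≤ n·s(m-1) + C(n,m-1)·δn·k·C(m+k-2,k-2); unrolled with Pascal's rule this gives
-- s(m) ≤ δk·n^m/m!·C(m+k-1,k-1).  With m = r-k both error terms are at most δk·n^m/m!·C(r,k-1).

module Submission where

open import Algebra.Properties.CommutativeSemigroup using (interchange)
open import Data.Bool using (Bool; true; false; _∧_; not; if_then_else_; T)
open import Data.Bool.ListAction using (and)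
open import Data.Bool.Properties using (∧-zeroʳ; ∧-identityʳ; ∧-comm)
open import Data.Empty using (⊥-elim)
open import Data.Fin.Subset using (Subset; inside; outside; ∣_∣; ⊥; ⊤; _∪_; _─_)
open import Data.Fin.Subset.Properties using (∣⊥∣≡0; ∣⊤∣≡n; ∣p∣≤n; ∪-identityˡ)
open import Data.Integer using (ℤ)
import Data.Integer as ℤ
import Data.Integer.Properties as ℤ
open import Data.List using (List; []; _∷_; _++_; map; filterᵇ; length)
open import Data.List.Membership.Propositional using (_∈_)
open import Data.List.Membership.Propositional.Properties using (∈-map⁺; ∈-++⁺ˡ; ∈-++⁺ʳ)
open import Data.List.Relation.Unary.Any using (here; there)
open import Data.Nat using (ℕ; zero; suc; _+_; _*_; _∸_; _^_; _≤_; _<_; _≡ᵇ_; _⊔_; _!; z≤n; s≤s; z<s; NonZero)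
open import Data.Nat.Combinatorics using (_C_; nCk+nC[k+1]≡[n+1]C[k+1]; k>n⇒nCk≡0)
open import Data.Nat.Divisibility using (∣1⇒≡1)
open import Data.Nat.Properties
import Data.Nat.Solver as ℕ-Solver
open import Data.Product using (∃; _×_; _,_; proj₁; proj₂)
open import Data.Rational using (ℚ; 0ℚ; 1ℚ; Positive; toℚᵘ; nonNegative; _/_; *<*)
  renaming (_+_ to _+ℚ_; _*_ to _*ℚ_; _-_ to _-ℚ_; _≤_ to _≤ℚ_; _<_ to _<ℚ_; -_ to -ℚ_)
import Data.Rational.Properties as ℚ
import Data.Rational.Solver as ℚ-Solver
import Data.Rational.Unnormalised as ℚᵘ
import Data.Rational.Unnormalised.Properties as ℚᵘ
open import Data.Sum using (inj₁; inj₂)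
open import Data.Vec using ([]; _∷_)
open import Relation.Binary.PropositionalEquality
open import Relation.Nullary using (¬_)

open import Defs

-- Sums and maxima over all subsets

𝟙 : Bool → ℕ
𝟙 true  = 1
𝟙 false = 0

𝟙-∧ : ∀ a b → 𝟙 (a ∧ b) ≡ 𝟙 a * 𝟙 b
𝟙-∧ true  b = sym (+-identityʳ (𝟙 b))
𝟙-∧ false b = refl

∑ : ∀ n → (Subset n → ℕ) → ℕ
∑ zero    f = f []
∑ (suc n) f = ∑ n (λ s → f (outside ∷ s)) + ∑ n (λ s → f (inside ∷ s))

∑-cong : ∀ n {f g : Subset n → ℕ} → (∀ s → f s ≡ g s) → ∑ n f ≡ ∑ n g
∑-cong zero    f≡g = f≡g []
∑-cong (suc n) f≡g = cong₂ _+_ (∑-cong n (λ s → f≡g _)) (∑-cong n (λ s → f≡g _))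

∑-mono : ∀ n {f g : Subset n → ℕ} → (∀ s → f s ≤ g s) → ∑ n f ≤ ∑ n g
∑-mono zero    f≤g = f≤g []
∑-mono (suc n) f≤g = +-mono-≤ (∑-mono n (λ s → f≤g _)) (∑-mono n (λ s → f≤g _))

∑-zero : ∀ n {f : Subset n → ℕ} → (∀ s → f s ≡ 0) → ∑ n f ≡ 0
∑-zero zero    f≡0 = f≡0 []
∑-zero (suc n) f≡0 = cong₂ _+_ (∑-zero n (λ s → f≡0 _)) (∑-zero n (λ s → f≡0 _))

∑-+ : ∀ n (f g : Subset n → ℕ) → ∑ n (λ s → f s + g s) ≡ ∑ n f + ∑ n g
∑-+ zero    f g = refl
∑-+ (suc n) f g =
  trans (cong₂ _+_ (∑-+ n (λ s → f (outside ∷ s)) (λ s → g (outside ∷ s)))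
                   (∑-+ n (λ s → f (inside ∷ s)) (λ s → g (inside ∷ s))))
        (interchange +-commutativeSemigroup (∑ n (λ s → f (outside ∷ s))) _ _ _)

∑-*ˡ : ∀ n c (f : Subset n → ℕ) → ∑ n (λ s → c * f s) ≡ c * ∑ n f
∑-*ˡ zero    c f = refl
∑-*ˡ (suc n) c f =
  trans (cong₂ _+_ (∑-*ˡ n c _) (∑-*ˡ n c _)) (sym (*-distribˡ-+ c _ _))

∑-*ʳ : ∀ n c (f : Subset n → ℕ) → ∑ n (λ s → f s * c) ≡ ∑ n f * c
∑-*ʳ n c f = trans (∑-cong n (λ s → *-comm (f s) c)) (trans (∑-*ˡ n c f) (*-comm c _))

∑-swap : ∀ n m (g : Subset n → Subset m → ℕ) →
  ∑ n (λ s → ∑ m (λ t → g s t)) ≡ ∑ m (λ t → ∑ n (λ s → g s t))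
∑-swap zero    m g = refl
∑-swap (suc n) m g =
  trans (cong₂ _+_ (∑-swap n m _) (∑-swap n m _)) (sym (∑-+ m _ _))

term≤∑ : ∀ n (f : Subset n → ℕ) s → f s ≤ ∑ n f
term≤∑ zero    f []            = ≤-refl
term≤∑ (suc n) f (outside ∷ s) = ≤-trans (term≤∑ n _ s) (m≤m+n _ _)
term≤∑ (suc n) f (inside ∷ s)  = ≤-trans (term≤∑ n _ s) (m≤n+m _ _)

⨆ : ∀ n → (Subset n → ℕ) → ℕ
⨆ zero    f = f []
⨆ (suc n) f = ⨆ n (λ s → f (outside ∷ s)) ⊔ ⨆ n (λ s → f (inside ∷ s))

term≤⨆ : ∀ n (f : Subset n → ℕ) s → f s ≤ ⨆ n f
term≤⨆ zero    f []            = ≤-refl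
term≤⨆ (suc n) f (outside ∷ s) = ≤-trans (term≤⨆ n _ s) (m≤m⊔n _ _)
term≤⨆ (suc n) f (inside ∷ s)  = ≤-trans (term≤⨆ n _ s) (m≤n⊔m _ _)

⨆-attained : ∀ n (f : Subset n → ℕ) → ∃ λ s → ⨆ n f ≡ f s
⨆-attained zero    f = [] , refl
⨆-attained (suc n) f with ⊔-sel (⨆ n (λ s → f (outside ∷ s))) (⨆ n (λ s → f (inside ∷ s)))
... | inj₁ eq = let s , att = ⨆-attained n _ in outside ∷ s , trans eq att
... | inj₂ eq = let s , att = ⨆-attained n _ in inside ∷ s , trans eq att

count-allSubsets≡∑ : ∀ n (P : Subset n → Bool) → length (filterᵇ P (allSubsets n)) ≡ ∑ n (λ s → 𝟙 (P s))
count-allSubsets≡∑ zero P with P []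
... | true  = refl
... | false = refl
count-allSubsets≡∑ (suc n) P = begin
  count P (map (outside ∷_) (allSubsets n) ++ map (inside ∷_) (allSubsets n))
    ≡⟨ count-++ (map (outside ∷_) (allSubsets n)) ⟩
  count P (map (outside ∷_) (allSubsets n)) + count P (map (inside ∷_) (allSubsets n))
    ≡⟨ cong₂ _+_ (count-map (outside ∷_) (allSubsets n)) (count-map (inside ∷_) (allSubsets n)) ⟩
  count (λ s → P (outside ∷ s)) (allSubsets n) + count (λ s → P (inside ∷ s)) (allSubsets n)
    ≡⟨ cong₂ _+_ (count-allSubsets≡∑ n _) (count-allSubsets≡∑ n _) ⟩
  ∑ (suc n) (λ s → 𝟙 (P s)) ∎
  where
  open ≡-Reasoning
  count : ∀ {A : Set} → (A → Bool) → List A → ℕ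
  count Q xs = length (filterᵇ Q xs)
  count-++ : ∀ {A : Set} {Q : A → Bool} xs {ys} → count Q (xs ++ ys) ≡ count Q xs + count Q ys
  count-++ []       = refl
  count-++ {Q = Q} (x ∷ xs) with Q x
  ... | true  = cong suc (count-++ xs)
  ... | false = count-++ xs
  count-map : ∀ {A B : Set} {Q : B → Bool} (g : A → B) xs → count Q (map g xs) ≡ count (λ x → Q (g x)) xs
  count-map g []       = refl
  count-map {Q = Q} g (x ∷ xs) with Q (g x)
  ... | true  = cong suc (count-map g xs)
  ... | false = count-map g xs

∈-allSubsets : ∀ {n} (s : Subset n) → s ∈ allSubsets n
∈-allSubsets []            = here refl
∈-allSubsets (outside ∷ s) = ∈-++⁺ˡ (∈-map⁺ (outside ∷_) (∈-allSubsets s))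
∈-allSubsets (inside ∷ s)  = ∈-++⁺ʳ _ (∈-map⁺ (inside ∷_) (∈-allSubsets s))

module _ {A : Set} (g : A → Bool) where

  and-map-elim : ∀ {xs x} → and (map g xs) ≡ true → x ∈ xs → g x ≡ true
  and-map-elim {y ∷ xs} all-true (here refl) with g y
  ... | true = refl
  and-map-elim {y ∷ xs} all-true (there x∈xs) with g y
  ... | true = and-map-elim all-true x∈xs

  and-map-intro : ∀ xs → (∀ x → g x ≡ true) → and (map g xs) ≡ true
  and-map-intro []       all-true = refl
  and-map-intro (x ∷ xs) all-true rewrite all-true x = and-map-intro xs all-true

  and-map-false : ∀ xs → and (map g xs) ≡ false → ∃ λ x → g x ≡ false
  and-map-false (x ∷ xs) fails with g x in gx
  ... | true  = and-map-false xs fails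
  ... | false = x , gx

-- Binomial coefficients

-- _C_ is defined by division; counting arguments use Pascal's recursion.
binomial : ℕ → ℕ → ℕ
binomial n       zero    = 1
binomial zero    (suc k) = 0
binomial (suc n) (suc k) = binomial n k + binomial n (suc k)

binomial≡C : ∀ n k → binomial n k ≡ n C k
binomial≡C n       zero    = refl
binomial≡C zero    (suc k) = sym (k>n⇒nCk≡0 {0} {suc k} z<s)
binomial≡C (suc n) (suc k) =
  trans (cong₂ _+_ (binomial≡C n k) (binomial≡C n (suc k))) (nCk+nC[k+1]≡[n+1]C[k+1] n k)

binomial-> : ∀ n k → n < k → binomial n k ≡ 0
binomial-> zero    (suc k) _         = refl
binomial-> (suc n) (suc k) (s≤s n<k) =
  cong₂ _+_ (binomial-> n k n<k) (binomial-> n (suc k) (m≤n⇒m≤1+n n<k))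

binomial-n-n : ∀ n → binomial n n ≡ 1
binomial-n-n zero    = refl
binomial-n-n (suc n) = cong₂ _+_ (binomial-n-n n) (binomial-> n (suc n) ≤-refl)

binomial-n-1 : ∀ n → binomial n 1 ≡ n
binomial-n-1 zero    = refl
binomial-n-1 (suc n) = cong suc (binomial-n-1 n)

binomial-1+n-n : ∀ n → binomial (suc n) n ≡ suc n
binomial-1+n-n zero    = refl
binomial-1+n-n (suc n) =
  trans (cong₂ _+_ (binomial-1+n-n n) (binomial-n-n (suc n))) (+-comm (suc n) 1)

binomial-pos : ∀ {n k} → k ≤ n → 1 ≤ binomial n k
binomial-pos {k = zero}  _         = ≤-refl
binomial-pos {k = suc k} (s≤s k≤n) = ≤-trans (binomial-pos k≤n) (m≤m+n _ _)

≤binomial : ∀ n k → 1 ≤ k → k < n → n ≤ binomial n k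
≤binomial (suc n) 1             _ _         = ≤-reflexive (sym (binomial-n-1 (suc n)))
≤binomial (suc n) (suc (suc k)) _ (s≤s k<n) =
  subst (_≤ binomial n (suc k) + binomial n (suc (suc k))) (+-comm n 1)
    (+-mono-≤ (≤binomial n (suc k) (s≤s z≤n) k<n) (binomial-pos k<n))

≡ᵇ⇒≡′ : ∀ {m n} → (m ≡ᵇ n) ≡ true → m ≡ n
≡ᵇ⇒≡′ {m} {n} eq = ≡ᵇ⇒≡ m n (subst T (sym eq) _)

≡⇒≡ᵇ′ : ∀ {m n} → m ≡ n → (m ≡ᵇ n) ≡ true
≡⇒≡ᵇ′ {m} {n} eq with m ≡ᵇ n | ≡⇒≡ᵇ m n eq
... | true | _ = refl

≢⇒≡ᵇ-false : ∀ {m n} → m ≢ n → (m ≡ᵇ n) ≡ false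
≢⇒≡ᵇ-false {m} {n} m≢n with m ≡ᵇ n in eq
... | true  = ⊥-elim (m≢n (≡ᵇ⇒≡′ eq))
... | false = refl

∧-trueˡ : ∀ {a b} → a ∧ b ≡ true → a ≡ true
∧-trueˡ {true} _ = refl

∧-trueʳ : ∀ {a b} → a ∧ b ≡ true → b ≡ true
∧-trueʳ {true} ab = ab

not≡true⇒≡false : ∀ {b} → not b ≡ true → b ≡ false
not≡true⇒≡false {false} _ = refl

true≢false : true ≢ false
true≢false ()

disjointᵇ : ∀ {n} → Subset n → Subset n → Bool
disjointᵇ []            []            = true
disjointᵇ (inside ∷ s)  (inside ∷ t)  = false
disjointᵇ (inside ∷ s)  (outside ∷ t) = disjointᵇ s t
disjointᵇ (outside ∷ s) (_ ∷ t)       = disjointᵇ s t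

⊥⊆ᵇ : ∀ {n} (s : Subset n) → ⊥ ⊆ᵇ s ≡ true
⊥⊆ᵇ []      = refl
⊥⊆ᵇ (_ ∷ s) = ⊥⊆ᵇ s

⊆ᵇ⊤ : ∀ {n} (s : Subset n) → s ⊆ᵇ ⊤ ≡ true
⊆ᵇ⊤ []            = refl
⊆ᵇ⊤ (inside ∷ s)  = ⊆ᵇ⊤ s
⊆ᵇ⊤ (outside ∷ s) = ⊆ᵇ⊤ s

⊆ᵇ-trans : ∀ {n} (s t u : Subset n) → s ⊆ᵇ t ≡ true → t ⊆ᵇ u ≡ true → s ⊆ᵇ u ≡ true
⊆ᵇ-trans []            []           []           _   _   = refl
⊆ᵇ-trans (outside ∷ s) (outside ∷ t) (_ ∷ u)     s⊆t t⊆u = ⊆ᵇ-trans s t u s⊆t t⊆u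
⊆ᵇ-trans (outside ∷ s) (inside ∷ t) (inside ∷ u) s⊆t t⊆u = ⊆ᵇ-trans s t u s⊆t t⊆u
⊆ᵇ-trans (inside ∷ s)  (inside ∷ t) (inside ∷ u) s⊆t t⊆u = ⊆ᵇ-trans s t u s⊆t t⊆u

⊆ᵇ⇒∣∣≤ : ∀ {n} (s t : Subset n) → s ⊆ᵇ t ≡ true → ∣ s ∣ ≤ ∣ t ∣
⊆ᵇ⇒∣∣≤ []            []            _   = z≤n
⊆ᵇ⇒∣∣≤ (outside ∷ s) (outside ∷ t) s⊆t = ⊆ᵇ⇒∣∣≤ s t s⊆t
⊆ᵇ⇒∣∣≤ (outside ∷ s) (inside ∷ t)  s⊆t = m≤n⇒m≤1+n (⊆ᵇ⇒∣∣≤ s t s⊆t)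
⊆ᵇ⇒∣∣≤ (inside ∷ s)  (inside ∷ t)  s⊆t = s≤s (⊆ᵇ⇒∣∣≤ s t s⊆t)

⊆ᵇ∧∣∣≡⇒≡ : ∀ {n} (s t : Subset n) → s ⊆ᵇ t ≡ true → ∣ s ∣ ≡ ∣ t ∣ → s ≡ t
⊆ᵇ∧∣∣≡⇒≡ []            []            _   _ = refl
⊆ᵇ∧∣∣≡⇒≡ (outside ∷ s) (outside ∷ t) s⊆t eq = cong (outside ∷_) (⊆ᵇ∧∣∣≡⇒≡ s t s⊆t eq)
⊆ᵇ∧∣∣≡⇒≡ (outside ∷ s) (inside ∷ t)  s⊆t eq = ⊥-elim (<⇒≢ (s≤s (⊆ᵇ⇒∣∣≤ s t s⊆t)) eq)
⊆ᵇ∧∣∣≡⇒≡ (inside ∷ s)  (inside ∷ t)  s⊆t eq = cong (inside ∷_) (⊆ᵇ∧∣∣≡⇒≡ s t s⊆t (suc-injective eq))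

∣∣≡0⇒≡⊥ : ∀ {n} (s : Subset n) → ∣ s ∣ ≡ 0 → s ≡ ⊥
∣∣≡0⇒≡⊥ []            _  = refl
∣∣≡0⇒≡⊥ (outside ∷ s) eq = cong (outside ∷_) (∣∣≡0⇒≡⊥ s eq)

⊆ᵇ-∪ˡ : ∀ {n} (s t : Subset n) → s ⊆ᵇ (s ∪ t) ≡ true
⊆ᵇ-∪ˡ []            []      = refl
⊆ᵇ-∪ˡ (outside ∷ s) (_ ∷ t) = ⊆ᵇ-∪ˡ s t
⊆ᵇ-∪ˡ (inside ∷ s)  (_ ∷ t) = ⊆ᵇ-∪ˡ s t

⊆ᵇ-∪ʳ : ∀ {n} (s t : Subset n) → t ⊆ᵇ (s ∪ t) ≡ true
⊆ᵇ-∪ʳ []            []            = refl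
⊆ᵇ-∪ʳ (_ ∷ s)       (outside ∷ t) = ⊆ᵇ-∪ʳ s t
⊆ᵇ-∪ʳ (outside ∷ s) (inside ∷ t)  = ⊆ᵇ-∪ʳ s t
⊆ᵇ-∪ʳ (inside ∷ s)  (inside ∷ t)  = ⊆ᵇ-∪ʳ s t

∣∪∣ : ∀ {n} (s t : Subset n) → disjointᵇ s t ≡ true → ∣ s ∪ t ∣ ≡ ∣ s ∣ + ∣ t ∣
∣∪∣ []            []            _ = refl
∣∪∣ (outside ∷ s) (outside ∷ t) d = ∣∪∣ s t d
∣∪∣ (outside ∷ s) (inside ∷ t)  d = trans (cong suc (∣∪∣ s t d)) (sym (+-suc _ _))
∣∪∣ (inside ∷ s)  (outside ∷ t) d = cong suc (∣∪∣ s t d)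

disjointᵇ-⊥ : ∀ {n} (s : Subset n) → disjointᵇ s ⊥ ≡ true
disjointᵇ-⊥ []            = refl
disjointᵇ-⊥ (outside ∷ s) = disjointᵇ-⊥ s
disjointᵇ-⊥ (inside ∷ s)  = disjointᵇ-⊥ s

disjointᵇ-∪ˡ : ∀ {n} (s t u : Subset n) → disjointᵇ (s ∪ t) u ≡ true → disjointᵇ s u ≡ true
disjointᵇ-∪ˡ []            []            []            _ = refl
disjointᵇ-∪ˡ (outside ∷ s) (outside ∷ t) (_ ∷ u)       d = disjointᵇ-∪ˡ s t u d
disjointᵇ-∪ˡ (outside ∷ s) (inside ∷ t)  (outside ∷ u) d = disjointᵇ-∪ˡ s t u d
disjointᵇ-∪ˡ (inside ∷ s)  (_ ∷ t)       (outside ∷ u) d = disjointᵇ-∪ˡ s t u d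

Singleton : ∀ {n} → Subset n → Set
Singleton v = ∣ v ∣ ≡ 1

singleton : ∀ n → Singleton (inside ∷ ⊥ {n})
singleton n = cong suc (∣⊥∣≡0 n)

∣∪-singleton∣ : ∀ {n} (s v : Subset n) → disjointᵇ s v ≡ true → Singleton v → ∣ s ∪ v ∣ ≡ suc ∣ s ∣
∣∪-singleton∣ s v s#v v₁ = trans (∣∪∣ s v s#v) (trans (cong (∣ s ∣ +_) v₁) (+-comm ∣ s ∣ 1))

¬disjointᵇ⇒common-point : ∀ {n} (s t : Subset n) → disjointᵇ s t ≡ false →
  ∃ λ v → Singleton v × v ⊆ᵇ t ≡ true × v ⊆ᵇ s ≡ true
¬disjointᵇ⇒common-point [] [] ()
¬disjointᵇ⇒common-point {suc n} (inside ∷ s) (inside ∷ t) _ = inside ∷ ⊥ , singleton n , ⊥⊆ᵇ t , ⊥⊆ᵇ s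
¬disjointᵇ⇒common-point (inside ∷ s) (outside ∷ t) d =
  let v , v₁ , v⊆t , v⊆s = ¬disjointᵇ⇒common-point s t d in outside ∷ v , v₁ , v⊆t , v⊆s
¬disjointᵇ⇒common-point (outside ∷ s) (_ ∷ t) d =
  let v , v₁ , v⊆t , v⊆s = ¬disjointᵇ⇒common-point s t d in outside ∷ v , v₁ , v⊆t , v⊆s

⊆ᵇ-∪∧⊈ᵇ⇒common-point : ∀ {n} (s t u : Subset n) → s ⊆ᵇ (t ∪ u) ≡ true → s ⊆ᵇ t ≡ false →
  ∃ λ v → Singleton v × v ⊆ᵇ u ≡ true × v ⊆ᵇ s ≡ true
⊆ᵇ-∪∧⊈ᵇ⇒common-point [] [] [] _ ()
⊆ᵇ-∪∧⊈ᵇ⇒common-point (inside ∷ s) (outside ∷ t) (outside ∷ u) () _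
⊆ᵇ-∪∧⊈ᵇ⇒common-point (outside ∷ s) (_ ∷ t) (_ ∷ u) s⊆ s⊈ =
  let v , v₁ , v⊆u , v⊆s = ⊆ᵇ-∪∧⊈ᵇ⇒common-point s t u s⊆ s⊈ in outside ∷ v , v₁ , v⊆u , v⊆s
⊆ᵇ-∪∧⊈ᵇ⇒common-point (inside ∷ s) (inside ∷ t) (_ ∷ u) s⊆ s⊈ =
  let v , v₁ , v⊆u , v⊆s = ⊆ᵇ-∪∧⊈ᵇ⇒common-point s t u s⊆ s⊈ in outside ∷ v , v₁ , v⊆u , v⊆s
⊆ᵇ-∪∧⊈ᵇ⇒common-point {suc n} (inside ∷ s) (outside ∷ t) (inside ∷ u) _ _ =
  inside ∷ ⊥ , singleton n , ⊥⊆ᵇ u , ⊥⊆ᵇ s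

⊆ᵇ-∪∧⊈ᵇ⇒¬disjointᵇ : ∀ {n} (f t u e : Subset n) →
  f ⊆ᵇ ((t ∪ u) ∪ e) ≡ true → f ⊆ᵇ (t ∪ e) ≡ false → disjointᵇ f u ≡ false
⊆ᵇ-∪∧⊈ᵇ⇒¬disjointᵇ []            []            []            []            _  ()
⊆ᵇ-∪∧⊈ᵇ⇒¬disjointᵇ (inside ∷ f)  (outside ∷ t) (outside ∷ u) (outside ∷ e) () _
⊆ᵇ-∪∧⊈ᵇ⇒¬disjointᵇ (outside ∷ f) (_ ∷ t)       (_ ∷ u)       (_ ∷ e)       f⊆ f⊈ = ⊆ᵇ-∪∧⊈ᵇ⇒¬disjointᵇ f t u e f⊆ f⊈
⊆ᵇ-∪∧⊈ᵇ⇒¬disjointᵇ (inside ∷ f)  (_ ∷ t)       (inside ∷ u)  (_ ∷ e)       f⊆ f⊈ = refl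
⊆ᵇ-∪∧⊈ᵇ⇒¬disjointᵇ (inside ∷ f)  (inside ∷ t)  (outside ∷ u) (_ ∷ e)       f⊆ f⊈ = ⊆ᵇ-∪∧⊈ᵇ⇒¬disjointᵇ f t u e f⊆ f⊈
⊆ᵇ-∪∧⊈ᵇ⇒¬disjointᵇ (inside ∷ f)  (outside ∷ t) (outside ∷ u) (inside ∷ e)  f⊆ f⊈ = ⊆ᵇ-∪∧⊈ᵇ⇒¬disjointᵇ f t u e f⊆ f⊈

¬disjointᵇ-singleton⇒⊆ᵇ : ∀ {n} (f v : Subset n) → disjointᵇ f v ≡ false → Singleton v → v ⊆ᵇ f ≡ true
¬disjointᵇ-singleton⇒⊆ᵇ (inside ∷ f)  (inside ∷ v)  _ v₁ rewrite ∣∣≡0⇒≡⊥ v (suc-injective v₁) = ⊥⊆ᵇ f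
¬disjointᵇ-singleton⇒⊆ᵇ (outside ∷ f) (inside ∷ v)  d v₁ rewrite ∣∣≡0⇒≡⊥ v (suc-injective v₁) =
  ⊥-elim (true≢false (trans (sym (disjointᵇ-⊥ f)) d))
¬disjointᵇ-singleton⇒⊆ᵇ (outside ∷ f) (outside ∷ v) d v₁ = ¬disjointᵇ-singleton⇒⊆ᵇ f v d v₁
¬disjointᵇ-singleton⇒⊆ᵇ (inside ∷ f)  (outside ∷ v) d v₁ = ¬disjointᵇ-singleton⇒⊆ᵇ f v d v₁

∪-─ : ∀ {n} (u f : Subset n) → u ⊆ᵇ f ≡ true → u ∪ (f ─ u) ≡ f
∪-─ []            []            _   = refl
∪-─ (outside ∷ u) (outside ∷ f) u⊆f = cong (outside ∷_) (∪-─ u f u⊆f)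
∪-─ (outside ∷ u) (inside ∷ f)  u⊆f = cong (inside ∷_) (∪-─ u f u⊆f)
∪-─ (inside ∷ u)  (inside ∷ f)  u⊆f = cong (inside ∷_) (∪-─ u f u⊆f)

disjointᵇ-─ : ∀ {n} (u f : Subset n) → disjointᵇ u (f ─ u) ≡ true
disjointᵇ-─ []            []            = refl
disjointᵇ-─ (outside ∷ u) (_ ∷ f)       = disjointᵇ-─ u f
disjointᵇ-─ (inside ∷ u)  (outside ∷ f) = disjointᵇ-─ u f
disjointᵇ-─ (inside ∷ u)  (inside ∷ f)  = disjointᵇ-─ u f

─-⊆ᵇ : ∀ {n} (f t u e : Subset n) → f ⊆ᵇ ((t ∪ u) ∪ e) ≡ true → (f ─ u) ⊆ᵇ (t ∪ e) ≡ true
─-⊆ᵇ []            []            []            []            _  = refl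
─-⊆ᵇ (outside ∷ f) (x ∷ t)       (outside ∷ u) (z ∷ e)       f⊆ = ─-⊆ᵇ f t u e f⊆
─-⊆ᵇ (outside ∷ f) (x ∷ t)       (inside ∷ u)  (z ∷ e)       f⊆ = ─-⊆ᵇ f t u e f⊆
─-⊆ᵇ (inside ∷ f)  (inside ∷ t)  (inside ∷ u)  (_ ∷ e)       f⊆ = ─-⊆ᵇ f t u e f⊆
─-⊆ᵇ (inside ∷ f)  (outside ∷ t) (inside ∷ u)  (outside ∷ e) f⊆ = ─-⊆ᵇ f t u e f⊆
─-⊆ᵇ (inside ∷ f)  (outside ∷ t) (inside ∷ u)  (inside ∷ e)  f⊆ = ─-⊆ᵇ f t u e f⊆
─-⊆ᵇ (inside ∷ f)  (inside ∷ t)  (outside ∷ u) (_ ∷ e)       f⊆ = ─-⊆ᵇ f t u e f⊆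
─-⊆ᵇ (inside ∷ f)  (outside ∷ t) (outside ∷ u) (inside ∷ e)  f⊆ = ─-⊆ᵇ f t u e f⊆
─-⊆ᵇ (inside ∷ f)  (outside ∷ t) (outside ∷ u) (outside ∷ e) ()

─-⊈ᵇ : ∀ {n} (f t u : Subset n) → f ⊆ᵇ (t ∪ u) ≡ false → (f ─ u) ⊆ᵇ t ≡ false
─-⊈ᵇ []            []            []            ()
─-⊈ᵇ (outside ∷ f) (x ∷ t)       (outside ∷ u) f⊈ = ─-⊈ᵇ f t u f⊈
─-⊈ᵇ (outside ∷ f) (x ∷ t)       (inside ∷ u)  f⊈ = ─-⊈ᵇ f t u f⊈
─-⊈ᵇ (inside ∷ f)  (inside ∷ t)  (outside ∷ u) f⊈ = ─-⊈ᵇ f t u f⊈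
─-⊈ᵇ (inside ∷ f)  (inside ∷ t)  (inside ∷ u)  f⊈ = ─-⊈ᵇ f t u f⊈
─-⊈ᵇ (inside ∷ f)  (outside ∷ t) (inside ∷ u)  f⊈ = ─-⊈ᵇ f t u f⊈
─-⊈ᵇ (inside ∷ f)  (outside ∷ t) (outside ∷ u) f⊈ = refl

∑-⊇≡∑-∪ : ∀ n (e : Subset n) (h : Subset n → ℕ) →
  ∑ n (λ R → 𝟙 (e ⊆ᵇ R) * h R) ≡ ∑ n (λ T → 𝟙 (disjointᵇ T e) * h (T ∪ e))
∑-⊇≡∑-∪ zero    []            h = refl
∑-⊇≡∑-∪ (suc n) (outside ∷ e) h =
  cong₂ _+_ (∑-⊇≡∑-∪ n e (λ R → h (outside ∷ R))) (∑-⊇≡∑-∪ n e (λ R → h (inside ∷ R)))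
∑-⊇≡∑-∪ (suc n) (inside ∷ e)  h = begin
  ∑ n (λ _ → 0) + ∑ n (λ R → 𝟙 (e ⊆ᵇ R) * h (inside ∷ R))
    ≡⟨ cong₂ _+_ (∑-zero n (λ _ → refl)) (∑-⊇≡∑-∪ n e (λ R → h (inside ∷ R))) ⟩
  0 + ∑ n (λ T → 𝟙 (disjointᵇ T e) * h (inside ∷ (T ∪ e)))
    ≡⟨ +-comm 0 _ ⟩
  ∑ n (λ T → 𝟙 (disjointᵇ T e) * h (inside ∷ (T ∪ e))) + 0
    ≡⟨ cong (∑ n (λ T → 𝟙 (disjointᵇ T e) * h (inside ∷ (T ∪ e))) +_) (∑-zero n (λ _ → refl)) ⟨
  ∑ n (λ T → 𝟙 (disjointᵇ T e) * h (inside ∷ (T ∪ e))) + ∑ n (λ _ → 0) ∎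
  where open ≡-Reasoning

-- Counting subsets

∑-interval : ∀ n (A B : Subset n) j → A ⊆ᵇ B ≡ true →
  ∑ n (λ S → 𝟙 ((A ⊆ᵇ S) ∧ (S ⊆ᵇ B) ∧ (∣ S ∣ ≡ᵇ j + ∣ A ∣))) ≡ binomial (∣ B ∣ ∸ ∣ A ∣) j
∑-interval zero    []            []            zero    _   = refl
∑-interval zero    []            []            (suc j) _   = refl
∑-interval (suc n) (outside ∷ A) (outside ∷ B) j       A⊆B =
  trans (cong₂ _+_ (∑-interval n A B j A⊆B) (∑-zero n (λ S → 𝟙-false (A ⊆ᵇ S) (suc ∣ S ∣ ≡ᵇ j + ∣ A ∣)))) (+-identityʳ _)
  where 𝟙-false : ∀ a c → 𝟙 (a ∧ false ∧ c) ≡ 0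
        𝟙-false true  c = refl
        𝟙-false false c = refl
∑-interval (suc n) (outside ∷ A) (inside ∷ B)  zero    A⊆B =
  trans (cong₂ _+_ (∑-interval n A B zero A⊆B) (∑-zero n too-small))
        (cong (λ m → binomial m 0) (sym (+-∸-assoc 1 (⊆ᵇ⇒∣∣≤ A B A⊆B))))
  where
  too-small : ∀ S → 𝟙 ((A ⊆ᵇ S) ∧ (S ⊆ᵇ B) ∧ (suc ∣ S ∣ ≡ᵇ ∣ A ∣)) ≡ 0
  too-small S with A ⊆ᵇ S in A⊆S
  ... | false = refl
  ... | true rewrite ≢⇒≡ᵇ-false (λ eq → <⇒≢ (s≤s (⊆ᵇ⇒∣∣≤ A S A⊆S)) (sym eq)) with S ⊆ᵇ B
  ...   | true  = refl
  ...   | false = refl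
∑-interval (suc n) (outside ∷ A) (inside ∷ B)  (suc j) A⊆B = begin
  ∑ n (λ S → 𝟙 ((A ⊆ᵇ S) ∧ (S ⊆ᵇ B) ∧ (∣ S ∣ ≡ᵇ suc j + ∣ A ∣)))
    + ∑ n (λ S → 𝟙 ((A ⊆ᵇ S) ∧ (S ⊆ᵇ B) ∧ (∣ S ∣ ≡ᵇ j + ∣ A ∣)))
    ≡⟨ cong₂ _+_ (∑-interval n A B (suc j) A⊆B) (∑-interval n A B j A⊆B) ⟩
  binomial (∣ B ∣ ∸ ∣ A ∣) (suc j) + binomial (∣ B ∣ ∸ ∣ A ∣) j
    ≡⟨ +-comm (binomial (∣ B ∣ ∸ ∣ A ∣) (suc j)) _ ⟩
  binomial (suc (∣ B ∣ ∸ ∣ A ∣)) (suc j)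
    ≡⟨ cong (λ m → binomial m (suc j)) (sym (+-∸-assoc 1 (⊆ᵇ⇒∣∣≤ A B A⊆B))) ⟩
  binomial (suc ∣ B ∣ ∸ ∣ A ∣) (suc j) ∎
  where open ≡-Reasoning
∑-interval (suc n) (inside ∷ A)  (inside ∷ B)  j       A⊆B =
  trans (cong₂ _+_ (∑-zero n (λ _ → refl))
                   (∑-cong n (λ S → cong (λ m → 𝟙 ((A ⊆ᵇ S) ∧ (S ⊆ᵇ B) ∧ (suc ∣ S ∣ ≡ᵇ m))) (+-suc j ∣ A ∣))))
        (∑-interval n A B j A⊆B)

∑-size : ∀ n j → ∑ n (λ S → 𝟙 (∣ S ∣ ≡ᵇ j)) ≡ binomial n j
∑-size n j = begin
  ∑ n (λ S → 𝟙 (∣ S ∣ ≡ᵇ j))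
    ≡⟨ ∑-cong n (λ S → cong 𝟙 (between S)) ⟩
  ∑ n (λ S → 𝟙 ((⊥ ⊆ᵇ S) ∧ (S ⊆ᵇ ⊤) ∧ (∣ S ∣ ≡ᵇ j + ∣ ⊥ {n} ∣)))
    ≡⟨ ∑-interval n ⊥ ⊤ j (⊥⊆ᵇ {n} ⊤) ⟩
  binomial (∣ ⊤ {n} ∣ ∸ ∣ ⊥ {n} ∣) j
    ≡⟨ cong₂ (λ a b → binomial (a ∸ b) j) (∣⊤∣≡n n) (∣⊥∣≡0 n) ⟩
  binomial n j ∎
  where
  open ≡-Reasoning
  between : ∀ S → (∣ S ∣ ≡ᵇ j) ≡ (⊥ ⊆ᵇ S) ∧ (S ⊆ᵇ ⊤) ∧ (∣ S ∣ ≡ᵇ j + ∣ ⊥ {n} ∣)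
  between S rewrite ⊥⊆ᵇ S | ⊆ᵇ⊤ S | ∣⊥∣≡0 n | +-identityʳ j = refl

∑-subsets : ∀ n (B : Subset n) j → ∑ n (λ S → 𝟙 ((S ⊆ᵇ B) ∧ (∣ S ∣ ≡ᵇ j))) ≡ binomial ∣ B ∣ j
∑-subsets n B j =
  trans (∑-cong n (λ S → cong 𝟙 (between S)))
        (trans (∑-interval n ⊥ B j (⊥⊆ᵇ B)) (cong (λ a → binomial (∣ B ∣ ∸ a) j) (∣⊥∣≡0 n)))
  where
  between : ∀ S → (S ⊆ᵇ B) ∧ (∣ S ∣ ≡ᵇ j) ≡ (⊥ ⊆ᵇ S) ∧ (S ⊆ᵇ B) ∧ (∣ S ∣ ≡ᵇ j + ∣ ⊥ {n} ∣)
  between S rewrite ⊥⊆ᵇ S | ∣⊥∣≡0 n | +-identityʳ j = refl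

∑-supersets : ∀ n (A : Subset n) j → ∑ n (λ S → 𝟙 ((A ⊆ᵇ S) ∧ (∣ S ∣ ≡ᵇ j + ∣ A ∣))) ≡ binomial (n ∸ ∣ A ∣) j
∑-supersets n A j =
  trans (∑-cong n (λ S → cong 𝟙 (between S)))
        (trans (∑-interval n A ⊤ j (⊆ᵇ⊤ A)) (cong (λ a → binomial (a ∸ ∣ A ∣) j) (∣⊤∣≡n n)))
  where
  between : ∀ S → (A ⊆ᵇ S) ∧ (∣ S ∣ ≡ᵇ j + ∣ A ∣) ≡ (A ⊆ᵇ S) ∧ (S ⊆ᵇ ⊤) ∧ (∣ S ∣ ≡ᵇ j + ∣ A ∣)
  between S rewrite ⊆ᵇ⊤ S = refl

∑-supersets-of-size : ∀ n (A : Subset n) {a b} → ∣ A ∣ ≡ a → a ≤ b →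
  ∑ n (λ S → 𝟙 ((A ⊆ᵇ S) ∧ (∣ S ∣ ≡ᵇ b))) ≡ binomial (n ∸ a) (b ∸ a)
∑-supersets-of-size n A refl a≤b =
  trans (∑-cong n (λ S → cong (λ x → 𝟙 ((A ⊆ᵇ S) ∧ (∣ S ∣ ≡ᵇ x))) (sym (m∸n+n≡m a≤b))))
        (∑-supersets n A _)

-- Both sides count the pairs A ⊆ B ⊆ [n] with ∣A∣ = a and ∣B∣ = b.
binomial-*-binomial : ∀ n a b → a ≤ b →
  binomial n a * binomial (n ∸ a) (b ∸ a) ≡ binomial n b * binomial b a
binomial-*-binomial n a b a≤b = begin
  binomial n a * binomial (n ∸ a) (b ∸ a)
    ≡⟨ cong (_* binomial (n ∸ a) (b ∸ a)) (sym (∑-size n a)) ⟩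
  ∑ n (λ A → 𝟙 (∣ A ∣ ≡ᵇ a)) * binomial (n ∸ a) (b ∸ a)
    ≡⟨ ∑-*ʳ n _ _ ⟨
  ∑ n (λ A → 𝟙 (∣ A ∣ ≡ᵇ a) * binomial (n ∸ a) (b ∸ a))
    ≡⟨ ∑-cong n supersets ⟩
  ∑ n (λ A → ∑ n (λ B → pair A B))
    ≡⟨ ∑-swap n n _ ⟩
  ∑ n (λ B → ∑ n (λ A → pair A B))
    ≡⟨ ∑-cong n subsets ⟩
  ∑ n (λ B → 𝟙 (∣ B ∣ ≡ᵇ b) * binomial b a)
    ≡⟨ ∑-*ʳ n _ _ ⟩
  ∑ n (λ B → 𝟙 (∣ B ∣ ≡ᵇ b)) * binomial b a
    ≡⟨ cong (_* binomial b a) (∑-size n b) ⟩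
  binomial n b * binomial b a ∎
  where
  open ≡-Reasoning
  pair : Subset n → Subset n → ℕ
  pair A B = 𝟙 ((∣ A ∣ ≡ᵇ a) ∧ (A ⊆ᵇ B) ∧ (∣ B ∣ ≡ᵇ b))
  supersets : ∀ A → 𝟙 (∣ A ∣ ≡ᵇ a) * binomial (n ∸ a) (b ∸ a) ≡ ∑ n (λ B → pair A B)
  supersets A with ∣ A ∣ ≡ᵇ a in ∣A∣≡a
  ... | false = sym (∑-zero n (λ _ → refl))
  ... | true  = trans (+-identityʳ _) (sym (∑-supersets-of-size n A (≡ᵇ⇒≡′ ∣A∣≡a) a≤b))
  subsets : ∀ B → ∑ n (λ A → pair A B) ≡ 𝟙 (∣ B ∣ ≡ᵇ b) * binomial b a
  subsets B with ∣ B ∣ ≡ᵇ b in ∣B∣≡b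
  ... | false = ∑-zero n (λ A → cong 𝟙 (trans (cong ((∣ A ∣ ≡ᵇ a) ∧_) (∧-zeroʳ (A ⊆ᵇ B))) (∧-zeroʳ _)))
  ... | true  = begin
    ∑ n (λ A → 𝟙 ((∣ A ∣ ≡ᵇ a) ∧ (A ⊆ᵇ B) ∧ true))
      ≡⟨ ∑-cong n (λ A → cong 𝟙 (trans (cong ((∣ A ∣ ≡ᵇ a) ∧_) (∧-identityʳ (A ⊆ᵇ B))) (∧-comm (∣ A ∣ ≡ᵇ a) (A ⊆ᵇ B)))) ⟩
    ∑ n (λ A → 𝟙 ((A ⊆ᵇ B) ∧ (∣ A ∣ ≡ᵇ a)))
      ≡⟨ ∑-subsets n B a ⟩
    binomial ∣ B ∣ a
      ≡⟨ cong (λ x → binomial x a) (≡ᵇ⇒≡′ ∣B∣≡b) ⟩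
    binomial b a
      ≡⟨ +-identityʳ _ ⟨
    binomial b a + 0 ∎

binomial-*-∸ : ∀ n j → binomial n j * (n ∸ j) ≡ binomial n (suc j) * suc j
binomial-*-∸ n j = begin
  binomial n j * (n ∸ j)
    ≡⟨ cong (binomial n j *_) (trans (cong (binomial (n ∸ j)) (m+n∸n≡m 1 j)) (binomial-n-1 (n ∸ j))) ⟨
  binomial n j * binomial (n ∸ j) (suc j ∸ j)
    ≡⟨ binomial-*-binomial n j (suc j) (n≤1+n j) ⟩
  binomial n (suc j) * binomial (suc j) j
    ≡⟨ cong (binomial n (suc j) *_) (binomial-1+n-n j) ⟩
  binomial n (suc j) * suc j ∎
  where open ≡-Reasoning

binomial-*-∸-*-binomial : ∀ n j r → suc j ≤ r →
  binomial n j * (n ∸ j) * binomial (n ∸ suc j) (r ∸ suc j) ≡ suc j * (binomial n r * binomial r (suc j))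
binomial-*-∸-*-binomial n j r j<r = begin
  binomial n j * (n ∸ j) * b                    ≡⟨ cong (_* b) (binomial-*-∸ n j) ⟩
  binomial n (suc j) * suc j * b                ≡⟨ cong (_* b) (*-comm (binomial n (suc j)) (suc j)) ⟩
  suc j * binomial n (suc j) * b                ≡⟨ *-assoc (suc j) (binomial n (suc j)) b ⟩
  suc j * (binomial n (suc j) * b)              ≡⟨ cong (suc j *_) (binomial-*-binomial n (suc j) r j<r) ⟩
  suc j * (binomial n r * binomial r (suc j))   ∎
  where
  open ≡-Reasoning
  b = binomial (n ∸ suc j) (r ∸ suc j)

binomial-absorption : ∀ n r → suc n * binomial n r ≡ binomial (suc n) (suc r) * suc r
binomial-absorption n r = begin
  suc n * binomial n r
    ≡⟨ cong (_* binomial n r) (binomial-n-1 (suc n)) ⟨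
  binomial (suc n) 1 * binomial n r
    ≡⟨ binomial-*-binomial (suc n) 1 (suc r) (s≤s z≤n) ⟩
  binomial (suc n) (suc r) * binomial (suc r) 1
    ≡⟨ cong (binomial (suc n) (suc r) *_) (binomial-n-1 (suc r)) ⟩
  binomial (suc n) (suc r) * suc r ∎
  where open ≡-Reasoning

binomial*!≤^ : ∀ n r → binomial n r * r ! ≤ n ^ r
binomial*!≤^ n       zero    = ≤-refl
binomial*!≤^ zero    (suc r) = z≤n
binomial*!≤^ (suc n) (suc r) = begin
  binomial (suc n) (suc r) * (suc r * r !) ≡⟨ *-assoc (binomial (suc n) (suc r)) (suc r) (r !) ⟨
  binomial (suc n) (suc r) * suc r * r !   ≡⟨ cong (_* r !) (binomial-absorption n r) ⟨
  suc n * binomial n r * r !               ≡⟨ *-assoc (suc n) (binomial n r) (r !) ⟩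
  suc n * (binomial n r * r !)             ≤⟨ *-monoʳ-≤ (suc n) (binomial*!≤^ n r) ⟩
  suc n * n ^ r                            ≤⟨ *-monoʳ-≤ (suc n) (^-monoˡ-≤ r (n≤1+n n)) ⟩
  suc n * suc n ^ r                        ∎
  where open ≤-Reasoning

-- Cliques and non-edges

module Cliques {k n : ℕ} (G : Hypergraph k n) where

  complete : Subset n → Bool
  complete S = and (map (λ T → if (∣ T ∣ ≡ᵇ k) ∧ (T ⊆ᵇ S) then isEdge G T else true) (allSubsets n))

  nonEdge : Subset n → Bool
  nonEdge f = (∣ f ∣ ≡ᵇ k) ∧ not (isEdge G f)

  missing : Subset n → ℕ
  missing S = ∑ n (λ f → 𝟙 (S ⊆ᵇ f) * 𝟙 (nonEdge f))

  nonEdgeCount : ℕ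
  nonEdgeCount = ∑ n (λ f → 𝟙 (nonEdge f))

  nonCliqueCount : ℕ → ℕ
  nonCliqueCount r = ∑ n (λ R → 𝟙 ((∣ R ∣ ≡ᵇ r) ∧ not (complete R)))

  cliqueCount≡∑ : ∀ j → cliqueCount G j ≡ ∑ n (λ S → 𝟙 ((∣ S ∣ ≡ᵇ j) ∧ complete S))
  cliqueCount≡∑ j = count-allSubsets≡∑ n (isClique G j)

  complete-elim : ∀ {S T} → complete S ≡ true → ∣ T ∣ ≡ k → T ⊆ᵇ S ≡ true → isEdge G T ≡ true
  complete-elim {S} {T} S-complete ∣T∣≡k T⊆S
    with and-map-elim _ S-complete (∈-allSubsets T)
  ... | T-ok rewrite ≡⇒≡ᵇ′ ∣T∣≡k | T⊆S = T-ok

  complete-intro : ∀ S → (∀ T → ∣ T ∣ ≡ k → T ⊆ᵇ S ≡ true → isEdge G T ≡ true) → complete S ≡ true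
  complete-intro S edges = and-map-intro _ (allSubsets n) ok
    where
    ok : ∀ T → (if (∣ T ∣ ≡ᵇ k) ∧ (T ⊆ᵇ S) then isEdge G T else true) ≡ true
    ok T with ∣ T ∣ ≡ᵇ k in ∣T∣≡k | T ⊆ᵇ S in T⊆S
    ... | true  | true  = edges T (≡ᵇ⇒≡′ ∣T∣≡k) T⊆S
    ... | true  | false = refl
    ... | false | _     = refl

  ¬complete⇒nonEdge : ∀ S → complete S ≡ false →
    ∃ λ f → (∣ f ∣ ≡ᵇ k) ≡ true × f ⊆ᵇ S ≡ true × isEdge G f ≡ false
  ¬complete⇒nonEdge S S-incomplete with and-map-false _ (allSubsets n) S-incomplete
  ... | f , f-bad with ∣ f ∣ ≡ᵇ k in ∣f∣≡k | f ⊆ᵇ S in f⊆S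
  ...   | true | true = f , ∣f∣≡k , f⊆S , f-bad

  complete-⊆ᵇ : ∀ {S T} → T ⊆ᵇ S ≡ true → complete S ≡ true → complete T ≡ true
  complete-⊆ᵇ {S} {T} T⊆S S-complete =
    complete-intro T (λ U ∣U∣≡k U⊆T → complete-elim S-complete ∣U∣≡k (⊆ᵇ-trans U T S U⊆T T⊆S))

  cliqueCount+nonCliqueCount : ∀ r → cliqueCount G r + nonCliqueCount r ≡ binomial n r
  cliqueCount+nonCliqueCount r = begin
    cliqueCount G r + nonCliqueCount r
      ≡⟨ cong (_+ nonCliqueCount r) (cliqueCount≡∑ r) ⟩
    ∑ n (λ S → 𝟙 ((∣ S ∣ ≡ᵇ r) ∧ complete S)) + nonCliqueCount r
      ≡⟨ ∑-+ n _ _ ⟨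
    ∑ n (λ S → 𝟙 ((∣ S ∣ ≡ᵇ r) ∧ complete S) + 𝟙 ((∣ S ∣ ≡ᵇ r) ∧ not (complete S)))
      ≡⟨ ∑-cong n (λ S → split (∣ S ∣ ≡ᵇ r) (complete S)) ⟩
    ∑ n (λ S → 𝟙 (∣ S ∣ ≡ᵇ r))
      ≡⟨ ∑-size n r ⟩
    binomial n r ∎
    where
    open ≡-Reasoning
    split : ∀ a b → 𝟙 (a ∧ b) + 𝟙 (a ∧ not b) ≡ 𝟙 a
    split true  true  = refl
    split true  false = refl
    split false _     = refl

  cliqueCount≤binomial : ∀ r → cliqueCount G r ≤ binomial n r
  cliqueCount≤binomial r = ≤-trans (m≤m+n _ _) (≤-reflexive (cliqueCount+nonCliqueCount r))

  -- Every non-clique r-set contains a non-edge, and each non-edge lies in C(n-k, r-k) r-sets.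
  nonCliqueCount≤ : ∀ r → k ≤ r → nonCliqueCount r ≤ nonEdgeCount * binomial (n ∸ k) (r ∸ k)
  nonCliqueCount≤ r k≤r = begin
    nonCliqueCount r
      ≤⟨ ∑-mono n contains-nonEdge ⟩
    ∑ n (λ R → ∑ n (λ f → 𝟙 (nonEdge f) * 𝟙 ((f ⊆ᵇ R) ∧ (∣ R ∣ ≡ᵇ r))))
      ≡⟨ ∑-swap n n _ ⟩
    ∑ n (λ f → ∑ n (λ R → 𝟙 (nonEdge f) * 𝟙 ((f ⊆ᵇ R) ∧ (∣ R ∣ ≡ᵇ r))))
      ≡⟨ ∑-cong n (λ f → trans (∑-*ˡ n (𝟙 (nonEdge f)) _) (supersets f)) ⟩
    ∑ n (λ f → 𝟙 (nonEdge f) * binomial (n ∸ k) (r ∸ k))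
      ≡⟨ ∑-*ʳ n _ _ ⟩
    nonEdgeCount * binomial (n ∸ k) (r ∸ k) ∎
    where
    open ≤-Reasoning
    contains-nonEdge : ∀ R → 𝟙 ((∣ R ∣ ≡ᵇ r) ∧ not (complete R))
                           ≤ ∑ n (λ f → 𝟙 (nonEdge f) * 𝟙 ((f ⊆ᵇ R) ∧ (∣ R ∣ ≡ᵇ r)))
    contains-nonEdge R with ∣ R ∣ ≡ᵇ r | complete R in R-complete
    ... | false | _    = z≤n
    ... | true  | true = z≤n
    ... | true  | false with ¬complete⇒nonEdge R R-complete
    ...   | f , ∣f∣≡k , f⊆R , f∉G =
      subst (_≤ ∑ n (λ f → 𝟙 (nonEdge f) * 𝟙 ((f ⊆ᵇ R) ∧ true))) one (term≤∑ n _ f)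
      where
      one : 𝟙 (nonEdge f) * 𝟙 ((f ⊆ᵇ R) ∧ true) ≡ 1
      one rewrite ∣f∣≡k | f⊆R | f∉G = refl
    supersets : ∀ f → 𝟙 (nonEdge f) * ∑ n (λ R → 𝟙 ((f ⊆ᵇ R) ∧ (∣ R ∣ ≡ᵇ r)))
                    ≡ 𝟙 (nonEdge f) * binomial (n ∸ k) (r ∸ k)
    supersets f with ∣ f ∣ ≡ᵇ k in ∣f∣≡k | isEdge G f
    ... | false | _     = refl
    ... | true  | true  = refl
    ... | true  | false = cong (_+ 0) (∑-supersets-of-size n f (≡ᵇ⇒≡′ ∣f∣≡k) k≤r)

module _ {K n : ℕ} (G : Hypergraph (suc K) n) where
  open Cliques G

  -- Each non-edge has exactly k faces of size k - 1.
  k*nonEdgeCount≤ : ∀ M → (∀ S → ∣ S ∣ ≡ K → missing S ≤ M) → suc K * nonEdgeCount ≤ binomial n K * M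
  k*nonEdgeCount≤ M missing≤M = begin
    suc K * nonEdgeCount
      ≡⟨ ∑-*ˡ n (suc K) _ ⟨
    ∑ n (λ f → suc K * 𝟙 (nonEdge f))
      ≡⟨ ∑-cong n faces ⟩
    ∑ n (λ f → ∑ n (λ S → 𝟙 ((S ⊆ᵇ f) ∧ (∣ S ∣ ≡ᵇ K)) * 𝟙 (nonEdge f)))
      ≡⟨ ∑-swap n n _ ⟩
    ∑ n (λ S → ∑ n (λ f → 𝟙 ((S ⊆ᵇ f) ∧ (∣ S ∣ ≡ᵇ K)) * 𝟙 (nonEdge f)))
      ≤⟨ ∑-mono n bounded ⟩
    ∑ n (λ S → 𝟙 (∣ S ∣ ≡ᵇ K) * M)
      ≡⟨ ∑-*ʳ n _ _ ⟩
    ∑ n (λ S → 𝟙 (∣ S ∣ ≡ᵇ K)) * M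
      ≡⟨ cong (_* M) (∑-size n K) ⟩
    binomial n K * M ∎
    where
    open ≤-Reasoning
    faces : ∀ f → suc K * 𝟙 (nonEdge f) ≡ ∑ n (λ S → 𝟙 ((S ⊆ᵇ f) ∧ (∣ S ∣ ≡ᵇ K)) * 𝟙 (nonEdge f))
    faces f with nonEdge f in f∉G
    ... | false = trans (*-zeroʳ (suc K)) (sym (∑-zero n (λ S → *-zeroʳ (𝟙 ((S ⊆ᵇ f) ∧ (∣ S ∣ ≡ᵇ K))))))
    ... | true  = begin-equality
      suc K * 1                                          ≡⟨ *-identityʳ _ ⟩
      suc K                                              ≡⟨ binomial-1+n-n K ⟨
      binomial (suc K) K                                 ≡⟨ cong (λ m → binomial m K) (≡ᵇ⇒≡′ (∧-trueˡ f∉G)) ⟨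
      binomial ∣ f ∣ K                                   ≡⟨ ∑-subsets n f K ⟨
      ∑ n (λ S → 𝟙 ((S ⊆ᵇ f) ∧ (∣ S ∣ ≡ᵇ K)))           ≡⟨ ∑-cong n (λ S → *-identityʳ _) ⟨
      ∑ n (λ S → 𝟙 ((S ⊆ᵇ f) ∧ (∣ S ∣ ≡ᵇ K)) * 1)       ∎
    bounded : ∀ S → ∑ n (λ f → 𝟙 ((S ⊆ᵇ f) ∧ (∣ S ∣ ≡ᵇ K)) * 𝟙 (nonEdge f)) ≤ 𝟙 (∣ S ∣ ≡ᵇ K) * M
    bounded S with ∣ S ∣ ≡ᵇ K in ∣S∣≡K
    ... | false = ≤-reflexive (∑-zero n (λ f → cong (λ b → 𝟙 b * 𝟙 (nonEdge f)) (∧-zeroʳ (S ⊆ᵇ f))))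
    ... | true  = begin
      ∑ n (λ f → 𝟙 ((S ⊆ᵇ f) ∧ true) * 𝟙 (nonEdge f))
        ≡⟨ ∑-cong n (λ f → cong (λ b → 𝟙 b * 𝟙 (nonEdge f)) (∧-identityʳ (S ⊆ᵇ f))) ⟩
      missing S
        ≤⟨ missing≤M S (≡ᵇ⇒≡′ ∣S∣≡K) ⟩
      M
        ≡⟨ +-identityʳ M ⟨
      M + 0 ∎

  -- A (k-1)-set S extends to a k-set in n - (k-1) ways, each an edge or a non-edge.
  missing+codegree : ∀ S → ∣ S ∣ ≡ K → missing S + codegree G S ≡ n ∸ K
  missing+codegree S ∣S∣≡K = begin
    missing S + codegree G S
      ≡⟨ cong (missing S +_) (count-allSubsets≡∑ n _) ⟩
    missing S + ∑ n (λ f → 𝟙 (isEdge G f ∧ (S ⊆ᵇ f)))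
      ≡⟨ ∑-+ n _ _ ⟨
    ∑ n (λ f → 𝟙 (S ⊆ᵇ f) * 𝟙 (nonEdge f) + 𝟙 (isEdge G f ∧ (S ⊆ᵇ f)))
      ≡⟨ ∑-cong n one-more ⟩
    ∑ n (λ f → 𝟙 ((S ⊆ᵇ f) ∧ (∣ f ∣ ≡ᵇ 1 + ∣ S ∣)))
      ≡⟨ ∑-supersets n S 1 ⟩
    binomial (n ∸ ∣ S ∣) 1
      ≡⟨ binomial-n-1 _ ⟩
    n ∸ ∣ S ∣
      ≡⟨ cong (n ∸_) ∣S∣≡K ⟩
    n ∸ K ∎
    where
    open ≡-Reasoning
    one-more : ∀ f → 𝟙 (S ⊆ᵇ f) * 𝟙 (nonEdge f) + 𝟙 (isEdge G f ∧ (S ⊆ᵇ f))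
                   ≡ 𝟙 ((S ⊆ᵇ f) ∧ (∣ f ∣ ≡ᵇ 1 + ∣ S ∣))
    one-more f rewrite ∣S∣≡K with S ⊆ᵇ f
    ... | false rewrite ∧-zeroʳ (isEdge G f) = refl
    ... | true with isEdge G f in f∈G
    ...   | true  rewrite ≡⇒≡ᵇ′ (uniform G f f∈G) = refl
    ...   | false rewrite ∧-identityʳ (∣ f ∣ ≡ᵇ suc K) = trans (+-identityʳ _) (+-identityʳ _)

-- Cliques through an edge

module _ {K n : ℕ} (G : Hypergraph (suc (suc K)) n) (e : Subset n) (e∈G : isEdge G e ≡ true) where
  open Cliques G

  private
    k : ℕ
    k = suc (suc K)

    ∣e∣≡k : ∣ e ∣ ≡ k
    ∣e∣≡k = uniform G e e∈G

  mixedNonEdge : Subset n → Subset n → Bool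
  mixedNonEdge T f = (∣ f ∣ ≡ᵇ k) ∧ (f ⊆ᵇ (T ∪ e)) ∧ not (f ⊆ᵇ T) ∧ not (f ⊆ᵇ e) ∧ not (isEdge G f)

  spoilt : Subset n → Bool
  spoilt T = not (and (map (λ f → not (mixedNonEdge T f)) (allSubsets n)))

  candidate : ℕ → Subset n → Bool
  candidate j T = (∣ T ∣ ≡ᵇ j) ∧ disjointᵇ T e

  spoiltCount : ℕ → ℕ
  spoiltCount j = ∑ n (λ T → 𝟙 (candidate j T ∧ spoilt T))

  meetingCount : ℕ → ℕ
  meetingCount j = ∑ n (λ T → 𝟙 ((∣ T ∣ ≡ᵇ j) ∧ not (disjointᵇ T e)))

  newFace : Subset n → Subset n → Bool
  newFace T S = (∣ S ∣ ≡ᵇ suc K) ∧ (S ⊆ᵇ (T ∪ e)) ∧ not (S ⊆ᵇ T)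

  completesNonEdge : Subset n → Subset n → ℕ
  completesNonEdge u S = 𝟙 (disjointᵇ u S) * 𝟙 (nonEdge (u ∪ S))

  spoilt-witness : ∀ T → spoilt T ≡ true → ∃ λ f → mixedNonEdge T f ≡ true
  spoilt-witness T T-spoilt
    with and-map-false _ (allSubsets n) (not≡true⇒≡false T-spoilt)
  ... | f , not-mixed with mixedNonEdge T f in f-mixed
  ...   | true = f , f-mixed

  ¬spoilt : ∀ T f → spoilt T ≡ false → mixedNonEdge T f ≡ false
  ¬spoilt T f T-unspoilt with and (map (λ f → not (mixedNonEdge T f)) (allSubsets n)) in all-unmixed
  ... | true = not≡true⇒≡false (and-map-elim _ all-unmixed (∈-allSubsets f))

  spoilt-intro : ∀ T f → mixedNonEdge T f ≡ true → spoilt T ≡ true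
  spoilt-intro T f f-mixed with spoilt T in T-spoilt
  ... | true  = refl
  ... | false = ⊥-elim (true≢false (trans (sym f-mixed) (¬spoilt T f T-spoilt)))

  spoiltCount-0 : spoiltCount 0 ≡ 0
  spoiltCount-0 = ∑-zero n no-spoilt-∅
    where
    ⊥-unmixed : ∀ f → not (mixedNonEdge ⊥ f) ≡ true
    ⊥-unmixed f rewrite ∪-identityˡ e with f ⊆ᵇ e
    ... | true  rewrite ∧-zeroʳ (not (f ⊆ᵇ ⊥)) | ∧-zeroʳ (∣ f ∣ ≡ᵇ k) = refl
    ... | false rewrite ∧-zeroʳ (∣ f ∣ ≡ᵇ k) = refl
    no-spoilt-∅ : ∀ T → 𝟙 (candidate 0 T ∧ spoilt T) ≡ 0
    no-spoilt-∅ T with ∣ T ∣ ≡ᵇ 0 in ∣T∣≡0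
    ... | false = refl
    ... | true rewrite ∣∣≡0⇒≡⊥ T (≡ᵇ⇒≡′ ∣T∣≡0)
                     | and-map-intro _ (allSubsets n) ⊥-unmixed
                     | ∧-zeroʳ (disjointᵇ ⊥ e) = refl

  spoilt-∪-singleton : ∀ {T u} → Singleton u → spoilt (T ∪ u) ≡ true → spoilt T ≡ false →
    ∃ λ S → newFace T S ≡ true × disjointᵇ u S ≡ true × nonEdge (u ∪ S) ≡ true
  spoilt-∪-singleton {T} {u} u₁ Tu-spoilt T-unspoilt with spoilt-witness (T ∪ u) Tu-spoilt
  ... | f , f-mixed
    with ∣ f ∣ ≡ᵇ k in ∣f∣≡k | f ⊆ᵇ ((T ∪ u) ∪ e) in f⊆Tue | f ⊆ᵇ (T ∪ u) in f⊆Tu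
       | f ⊆ᵇ e in f⊆e | isEdge G f in f∈G
  ...   | true | true | false | false | false =
    f ─ u , face , disjointᵇ-─ u f , subst (λ g → nonEdge g ≡ true) (sym (∪-─ u f u⊆f)) f-nonEdge
    where
    f-nonEdge : nonEdge f ≡ true
    f-nonEdge rewrite ∣f∣≡k | f∈G = refl
    f⊈T : f ⊆ᵇ T ≡ false
    f⊈T with f ⊆ᵇ T in f⊆T
    ... | false = refl
    ... | true  = ⊥-elim (true≢false (trans (sym (⊆ᵇ-trans f T (T ∪ u) f⊆T (⊆ᵇ-∪ˡ T u))) f⊆Tu))
    f⊈Te : f ⊆ᵇ (T ∪ e) ≡ false
    f⊈Te with f ⊆ᵇ (T ∪ e) in f⊆Te
    ... | false = refl
    ... | true  = ⊥-elim (true≢false (trans (sym T-mixed) (¬spoilt T f T-unspoilt)))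
      where
      T-mixed : mixedNonEdge T f ≡ true
      T-mixed rewrite ∣f∣≡k | f⊆Te | f⊈T | f⊆e | f∈G = refl
    u⊆f : u ⊆ᵇ f ≡ true
    u⊆f = ¬disjointᵇ-singleton⇒⊆ᵇ f u (⊆ᵇ-∪∧⊈ᵇ⇒¬disjointᵇ f T u e f⊆Tue f⊈Te) u₁
    ∣f─u∣ : ∣ f ─ u ∣ ≡ suc K
    ∣f─u∣ = suc-injective (begin
      suc ∣ f ─ u ∣        ≡⟨ cong (_+ ∣ f ─ u ∣) u₁ ⟨
      ∣ u ∣ + ∣ f ─ u ∣    ≡⟨ ∣∪∣ u (f ─ u) (disjointᵇ-─ u f) ⟨
      ∣ u ∪ (f ─ u) ∣      ≡⟨ cong ∣_∣ (∪-─ u f u⊆f) ⟩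
      ∣ f ∣                ≡⟨ ≡ᵇ⇒≡′ ∣f∣≡k ⟩
      k                    ∎)
      where open ≡-Reasoning
    face : newFace T (f ─ u) ≡ true
    face rewrite ≡⇒≡ᵇ′ ∣f─u∣ | ─-⊆ᵇ f T u e f⊆Tue | ─-⊈ᵇ f T u f⊆Tu = refl

  candidate-∪-singleton : ∀ {j T u} → Singleton u → disjointᵇ T u ≡ true →
    candidate (suc j) (T ∪ u) ≡ true → candidate j T ≡ true
  candidate-∪-singleton {j} {T} {u} u₁ T#u Tu-candidate
    rewrite ≡⇒≡ᵇ′ (suc-injective (trans (sym (∣∪-singleton∣ T u T#u u₁)) (≡ᵇ⇒≡′ (∧-trueˡ Tu-candidate))))
          | disjointᵇ-∪ˡ T u e (∧-trueʳ {∣ T ∪ u ∣ ≡ᵇ suc j} Tu-candidate) = refl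

  -- Adding a point u to T: either T was already spoilt, or a new face S of T ∪ e completes a non-edge with u.
  spoilt-extension : ∀ j u T →
    𝟙 (∣ u ∣ ≡ᵇ 1) * (𝟙 (disjointᵇ T u) * 𝟙 (candidate (suc j) (T ∪ u) ∧ spoilt (T ∪ u)))
      ≤ 𝟙 (∣ u ∣ ≡ᵇ 1) * 𝟙 (candidate j T ∧ spoilt T)
        + ∑ n (λ S → 𝟙 (candidate j T) * 𝟙 (newFace T S) * completesNonEdge u S)
  spoilt-extension j u T
    with ∣ u ∣ ≡ᵇ 1 in ∣u∣≡1 | disjointᵇ T u in T#u
       | candidate (suc j) (T ∪ u) in Tu-candidate | spoilt (T ∪ u) in Tu-spoilt
  ... | false | _     | _     | _     = z≤n
  ... | true  | false | _     | _     = z≤n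
  ... | true  | true  | false | _     = z≤n
  ... | true  | true  | true  | false = z≤n
  ... | true  | true  | true  | true  with spoilt T in T-spoilt
  ...   | true  = ≤-trans (≤-reflexive (sym T-counted)) (m≤m+n _ _)
    where
    T-counted : 1 * 𝟙 (candidate j T ∧ true) ≡ 1
    T-counted = cong (λ b → 1 * 𝟙 (b ∧ true)) (candidate-∪-singleton {j} {T} {u} (≡ᵇ⇒≡′ ∣u∣≡1) T#u Tu-candidate)
  ...   | false with spoilt-∪-singleton (≡ᵇ⇒≡′ ∣u∣≡1) Tu-spoilt T-spoilt
  ...     | S , S-face , u#S , uS-nonEdge =
    ≤-trans (≤-reflexive (sym S-counted)) (≤-trans (term≤∑ n _ S) (m≤n+m _ _))
    where
    S-counted : 𝟙 (candidate j T) * 𝟙 (newFace T S) * completesNonEdge u S ≡ 1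
    S-counted rewrite S-face | u#S | uS-nonEdge =
      cong (λ b → 𝟙 b * 1 * (1 + 0)) (candidate-∪-singleton {j} {T} {u} (≡ᵇ⇒≡′ ∣u∣≡1) T#u Tu-candidate)

  newFace⇒ : ∀ T S → newFace T S ≡ true → ∣ S ∣ ≡ suc K × S ⊆ᵇ (T ∪ e) ≡ true × S ⊆ᵇ T ≡ false
  newFace⇒ T S S-face with ∣ S ∣ ≡ᵇ suc K in ∣S∣≡1+K | S ⊆ᵇ (T ∪ e) | S ⊆ᵇ T
  ... | true | true | false = ≡ᵇ⇒≡′ ∣S∣≡1+K , refl , refl

  -- A new face meets e; choose that point of e, then the other K points inside T ∪ e.
  ∑-newFace≤ : ∀ j T → ∣ T ∣ ≡ j → disjointᵇ T e ≡ true →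
    ∑ n (λ S → 𝟙 (newFace T S)) ≤ k * binomial (j + suc K) K
  ∑-newFace≤ j T ∣T∣≡j T#e = begin
    ∑ n (λ S → 𝟙 (newFace T S))
      ≤⟨ ∑-mono n through-point ⟩
    ∑ n (λ S → ∑ n (λ v → point v * between v S))
      ≡⟨ ∑-swap n n _ ⟩
    ∑ n (λ v → ∑ n (λ S → point v * between v S))
      ≡⟨ ∑-cong n (λ v → trans (∑-*ˡ n (point v) (between v)) (extensions v)) ⟩
    ∑ n (λ v → point v * binomial (j + suc K) K)
      ≡⟨ ∑-*ʳ n _ _ ⟩
    ∑ n (λ v → point v) * binomial (j + suc K) K
      ≡⟨ cong (_* binomial (j + suc K) K) (trans (∑-subsets n e 1) (trans (binomial-n-1 _) ∣e∣≡k)) ⟩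
    k * binomial (j + suc K) K ∎
    where
    open ≤-Reasoning
    point : Subset n → ℕ
    point v = 𝟙 ((v ⊆ᵇ e) ∧ (∣ v ∣ ≡ᵇ 1))
    between : Subset n → Subset n → ℕ
    between v S = 𝟙 ((v ⊆ᵇ S) ∧ (S ⊆ᵇ (T ∪ e)) ∧ (∣ S ∣ ≡ᵇ K + ∣ v ∣))
    through-point : ∀ S → 𝟙 (newFace T S) ≤ ∑ n (λ v → point v * between v S)
    through-point S with newFace T S in S-face
    ... | false = z≤n
    ... | true with newFace⇒ T S S-face
    ...   | ∣S∣≡1+K , S⊆Te , S⊈T with ⊆ᵇ-∪∧⊈ᵇ⇒common-point S T e S⊆Te S⊈T
    ...     | v , v₁ , v⊆e , v⊆S = subst (_≤ ∑ n (λ v → point v * between v S)) counted (term≤∑ n _ v)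
      where
      ∣S∣≡K+∣v∣ : ∣ S ∣ ≡ K + ∣ v ∣
      ∣S∣≡K+∣v∣ = trans ∣S∣≡1+K (trans (+-comm 1 K) (cong (K +_) (sym v₁)))
      counted : point v * between v S ≡ 1
      counted = cong₂ (λ a b → 𝟙 a * 𝟙 b) (cong₂ _∧_ v⊆e (≡⇒≡ᵇ′ v₁))
                      (cong₂ _∧_ v⊆S (cong₂ _∧_ S⊆Te (≡⇒≡ᵇ′ ∣S∣≡K+∣v∣)))
    ∣Te∣∸1 : ∣ T ∪ e ∣ ∸ 1 ≡ j + suc K
    ∣Te∣∸1 = cong (_∸ 1) (trans (∣∪∣ T e T#e) (trans (cong₂ _+_ ∣T∣≡j ∣e∣≡k) (+-suc j (suc K))))
    extensions : ∀ v → point v * ∑ n (between v) ≡ point v * binomial (j + suc K) K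
    extensions v with v ⊆ᵇ e in v⊆e | ∣ v ∣ ≡ᵇ 1 in ∣v∣≡1
    ... | false | _     = refl
    ... | true  | false = refl
    ... | true  | true  = cong (_+ 0) (begin-equality
      ∑ n (between v)
        ≡⟨ ∑-interval n v (T ∪ e) K (⊆ᵇ-trans v e (T ∪ e) v⊆e (⊆ᵇ-∪ʳ T e)) ⟩
      binomial (∣ T ∪ e ∣ ∸ ∣ v ∣) K
        ≡⟨ cong (λ m → binomial (∣ T ∪ e ∣ ∸ m) K) (≡ᵇ⇒≡′ {∣ v ∣} {1} ∣v∣≡1) ⟩
      binomial (∣ T ∪ e ∣ ∸ 1) K
        ≡⟨ cong (λ m → binomial m K) ∣Te∣∸1 ⟩
      binomial (j + suc K) K ∎)

  cliquesContaining≡∑ : ∀ r → cliquesContaining G r e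
                            ≡ ∑ n (λ T → 𝟙 (disjointᵇ T e) * 𝟙 ((∣ T ∪ e ∣ ≡ᵇ r) ∧ complete (T ∪ e)))
  cliquesContaining≡∑ r = begin
    cliquesContaining G r e
      ≡⟨ count-allSubsets≡∑ n (λ S → isClique G r S ∧ (e ⊆ᵇ S)) ⟩
    ∑ n (λ S → 𝟙 (isClique G r S ∧ (e ⊆ᵇ S)))
      ≡⟨ ∑-cong n (λ S → trans (cong 𝟙 (∧-comm (isClique G r S) (e ⊆ᵇ S))) (𝟙-∧ (e ⊆ᵇ S) _)) ⟩
    ∑ n (λ S → 𝟙 (e ⊆ᵇ S) * 𝟙 ((∣ S ∣ ≡ᵇ r) ∧ complete S))
      ≡⟨ ∑-⊇≡∑-∪ n e (λ S → 𝟙 ((∣ S ∣ ≡ᵇ r) ∧ complete S)) ⟩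
    ∑ n (λ T → 𝟙 (disjointᵇ T e) * 𝟙 ((∣ T ∪ e ∣ ≡ᵇ r) ∧ complete (T ∪ e))) ∎
    where open ≡-Reasoning

  ∣∪e∣ : ∀ T → disjointᵇ T e ≡ true → ∣ T ∪ e ∣ ≡ ∣ T ∣ + k
  ∣∪e∣ T T#e = trans (∣∪∣ T e T#e) (cong (∣ T ∣ +_) ∣e∣≡k)

  cliquesContaining≤cliqueCount : ∀ r → cliquesContaining G r e ≤ cliqueCount G (r ∸ k)
  cliquesContaining≤cliqueCount r = begin
    cliquesContaining G r e
      ≡⟨ cliquesContaining≡∑ r ⟩
    ∑ n (λ T → 𝟙 (disjointᵇ T e) * 𝟙 ((∣ T ∪ e ∣ ≡ᵇ r) ∧ complete (T ∪ e)))
      ≤⟨ ∑-mono n restrict ⟩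
    ∑ n (λ T → 𝟙 ((∣ T ∣ ≡ᵇ r ∸ k) ∧ complete T))
      ≡⟨ cliqueCount≡∑ (r ∸ k) ⟨
    cliqueCount G (r ∸ k) ∎
    where
    open ≤-Reasoning
    restrict : ∀ T → 𝟙 (disjointᵇ T e) * 𝟙 ((∣ T ∪ e ∣ ≡ᵇ r) ∧ complete (T ∪ e))
                   ≤ 𝟙 ((∣ T ∣ ≡ᵇ r ∸ k) ∧ complete T)
    restrict T with disjointᵇ T e in T#e | ∣ T ∪ e ∣ ≡ᵇ r in ∣Te∣≡r | complete (T ∪ e) in Te-complete
    ... | false | _     | _     = z≤n
    ... | true  | false | _     = z≤n
    ... | true  | true  | false = z≤n
    ... | true  | true  | true  = ≤-reflexive (sym (cong₂ (λ a b → 𝟙 (a ∧ b))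
                                    (≡⇒≡ᵇ′ ∣T∣≡r∸k) (complete-⊆ᵇ (⊆ᵇ-∪ˡ T e) Te-complete)))
      where
      ∣T∣≡r∸k : ∣ T ∣ ≡ r ∸ k
      ∣T∣≡r∸k = trans (sym (m+n∸n≡m ∣ T ∣ k)) (cong (_∸ k) (trans (sym (∣∪e∣ T T#e)) (≡ᵇ⇒≡′ ∣Te∣≡r)))

  -- An (r-k)-clique T misses the count κ only if it meets e or T ∪ e is not a clique;
  -- in the latter case some non-edge of T ∪ e meets both T and e, so T is spoilt.
  cliqueCount≤cliquesContaining+ : ∀ r → k ≤ r →
    cliqueCount G (r ∸ k) ≤ cliquesContaining G r e + (meetingCount (r ∸ k) + spoiltCount (r ∸ k))
  cliqueCount≤cliquesContaining+ r k≤r = begin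
    cliqueCount G (r ∸ k)
      ≡⟨ cliqueCount≡∑ (r ∸ k) ⟩
    ∑ n (λ T → 𝟙 ((∣ T ∣ ≡ᵇ r ∸ k) ∧ complete T))
      ≤⟨ ∑-mono n classify ⟩
    ∑ n (λ T → 𝟙 (disjointᵇ T e) * 𝟙 ((∣ T ∪ e ∣ ≡ᵇ r) ∧ complete (T ∪ e))
               + (𝟙 ((∣ T ∣ ≡ᵇ r ∸ k) ∧ not (disjointᵇ T e)) + 𝟙 (candidate (r ∸ k) T ∧ spoilt T)))
      ≡⟨ ∑-+ n _ _ ⟩
    ∑ n (λ T → 𝟙 (disjointᵇ T e) * 𝟙 ((∣ T ∪ e ∣ ≡ᵇ r) ∧ complete (T ∪ e)))
      + ∑ n (λ T → 𝟙 ((∣ T ∣ ≡ᵇ r ∸ k) ∧ not (disjointᵇ T e)) + 𝟙 (candidate (r ∸ k) T ∧ spoilt T))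
      ≡⟨ cong₂ _+_ (cliquesContaining≡∑ r) (sym (∑-+ n _ _)) ⟨
    cliquesContaining G r e + (meetingCount (r ∸ k) + spoiltCount (r ∸ k)) ∎
    where
    open ≤-Reasoning
    classify : ∀ T → 𝟙 ((∣ T ∣ ≡ᵇ r ∸ k) ∧ complete T)
                   ≤ 𝟙 (disjointᵇ T e) * 𝟙 ((∣ T ∪ e ∣ ≡ᵇ r) ∧ complete (T ∪ e))
                     + (𝟙 ((∣ T ∣ ≡ᵇ r ∸ k) ∧ not (disjointᵇ T e)) + 𝟙 (candidate (r ∸ k) T ∧ spoilt T))
    classify T with ∣ T ∣ ≡ᵇ r ∸ k in ∣T∣≡r∸k | complete T in T-complete
    ... | false | _    = z≤n
    ... | true  | false = z≤n
    ... | true  | true with disjointᵇ T e in T#e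
    ...   | false = s≤s z≤n
    ...   | true with complete (T ∪ e) in Te-complete
    ...     | true  = ≤-trans (≤-reflexive (sym counted)) (m≤m+n _ _)
      where
      counted : 1 * 𝟙 ((∣ T ∪ e ∣ ≡ᵇ r) ∧ true) ≡ 1
      counted rewrite ≡⇒≡ᵇ′ (trans (∣∪e∣ T T#e) (trans (cong (_+ k) (≡ᵇ⇒≡′ ∣T∣≡r∸k)) (m∸n+n≡m k≤r))) = refl
    ...     | false with ¬complete⇒nonEdge (T ∪ e) Te-complete
    ...       | f , ∣f∣≡k , f⊆Te , f∉G = ≤-trans (≤-reflexive (sym (cong 𝟙 (spoilt-intro T f T-mixed)))) (m≤n+m _ _)
      where
      f⊈T : f ⊆ᵇ T ≡ false
      f⊈T with f ⊆ᵇ T in f⊆T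
      ... | false = refl
      ... | true  = ⊥-elim (true≢false (trans (sym (complete-elim T-complete (≡ᵇ⇒≡′ ∣f∣≡k) f⊆T)) f∉G))
      f⊈e : f ⊆ᵇ e ≡ false
      f⊈e with f ⊆ᵇ e in f⊆e
      ... | false = refl
      ... | true  = ⊥-elim (true≢false (trans (sym e∈G) (trans (cong (isEdge G) (sym f≡e)) f∉G)))
        where f≡e = ⊆ᵇ∧∣∣≡⇒≡ f e f⊆e (trans (≡ᵇ⇒≡′ ∣f∣≡k) (sym ∣e∣≡k))
      T-mixed : mixedNonEdge T f ≡ true
      T-mixed rewrite ∣f∣≡k | f⊆Te | f⊈T | f⊈e | f∉G = refl

  meetingCount≤ : ∀ m → meetingCount (suc m) ≤ k * binomial (n ∸ 1) m
  meetingCount≤ m = begin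
    meetingCount (suc m)
      ≤⟨ ∑-mono n through-point ⟩
    ∑ n (λ T → ∑ n (λ v → point v * above v T))
      ≡⟨ ∑-swap n n _ ⟩
    ∑ n (λ v → ∑ n (λ T → point v * above v T))
      ≡⟨ ∑-cong n (λ v → trans (∑-*ˡ n (point v) (above v)) (extensions v)) ⟩
    ∑ n (λ v → point v * binomial (n ∸ 1) m)
      ≡⟨ ∑-*ʳ n _ _ ⟩
    ∑ n point * binomial (n ∸ 1) m
      ≡⟨ cong (_* binomial (n ∸ 1) m) (trans (∑-subsets n e 1) (trans (binomial-n-1 _) ∣e∣≡k)) ⟩
    k * binomial (n ∸ 1) m ∎
    where
    open ≤-Reasoning
    point : Subset n → ℕ
    point v = 𝟙 ((v ⊆ᵇ e) ∧ (∣ v ∣ ≡ᵇ 1))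
    above : Subset n → Subset n → ℕ
    above v T = 𝟙 ((v ⊆ᵇ T) ∧ (∣ T ∣ ≡ᵇ m + ∣ v ∣))
    through-point : ∀ T → 𝟙 ((∣ T ∣ ≡ᵇ suc m) ∧ not (disjointᵇ T e)) ≤ ∑ n (λ v → point v * above v T)
    through-point T with ∣ T ∣ ≡ᵇ suc m in ∣T∣≡1+m | disjointᵇ T e in T#e
    ... | false | _    = z≤n
    ... | true  | true = z≤n
    ... | true  | false with ¬disjointᵇ⇒common-point T e T#e
    ...   | v , v₁ , v⊆e , v⊆T = subst (_≤ ∑ n (λ v → point v * above v T)) counted (term≤∑ n _ v)
      where
      ∣T∣≡m+∣v∣ : ∣ T ∣ ≡ m + ∣ v ∣
      ∣T∣≡m+∣v∣ = trans (≡ᵇ⇒≡′ ∣T∣≡1+m) (trans (+-comm 1 m) (cong (m +_) (sym v₁)))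
      counted : point v * above v T ≡ 1
      counted = cong₂ (λ a b → 𝟙 a * 𝟙 b) (cong₂ _∧_ v⊆e (≡⇒≡ᵇ′ v₁)) (cong₂ _∧_ v⊆T (≡⇒≡ᵇ′ ∣T∣≡m+∣v∣))
    extensions : ∀ v → point v * ∑ n (above v) ≡ point v * binomial (n ∸ 1) m
    extensions v with v ⊆ᵇ e | ∣ v ∣ ≡ᵇ 1 in ∣v∣≡1
    ... | false | _     = refl
    ... | true  | false = refl
    ... | true  | true  = cong (_+ 0) (trans (∑-supersets n v m)
                                             (cong (λ x → binomial (n ∸ x) m) (≡ᵇ⇒≡′ {∣ v ∣} {1} ∣v∣≡1)))
  module _ (M : ℕ) (missing≤M : ∀ S → ∣ S ∣ ≡ suc K → missing S ≤ M) where

    ∑-newNonEdges≤ : ∀ j →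
      ∑ n (λ u → ∑ n (λ T → ∑ n (λ S → 𝟙 (candidate j T) * 𝟙 (newFace T S) * completesNonEdge u S)))
        ≤ binomial n j * (M * (k * binomial (j + suc K) K))
    ∑-newNonEdges≤ j = begin
      ∑ n (λ u → ∑ n (λ T → ∑ n (λ S → 𝟙 (candidate j T) * 𝟙 (newFace T S) * completesNonEdge u S)))
        ≡⟨ ∑-swap n n _ ⟩
      ∑ n (λ T → ∑ n (λ u → ∑ n (λ S → 𝟙 (candidate j T) * 𝟙 (newFace T S) * completesNonEdge u S)))
        ≡⟨ ∑-cong n (λ T → ∑-swap n n _) ⟩
      ∑ n (λ T → ∑ n (λ S → ∑ n (λ u → 𝟙 (candidate j T) * 𝟙 (newFace T S) * completesNonEdge u S)))
        ≡⟨ ∑-cong n (λ T → ∑-cong n (λ S → completions T S)) ⟩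
      ∑ n (λ T → ∑ n (λ S → 𝟙 (candidate j T) * 𝟙 (newFace T S) * missing S))
        ≤⟨ ∑-mono n (λ T → ∑-mono n (λ S → missing≤M-on-faces T S)) ⟩
      ∑ n (λ T → ∑ n (λ S → 𝟙 (candidate j T) * 𝟙 (newFace T S) * M))
        ≡⟨ ∑-cong n (λ T → trans (∑-cong n (λ S → *-comm-right (𝟙 (candidate j T)) (𝟙 (newFace T S)) M))
                                 (∑-*ˡ n (𝟙 (candidate j T) * M) (λ S → 𝟙 (newFace T S)))) ⟩
      ∑ n (λ T → 𝟙 (candidate j T) * M * ∑ n (λ S → 𝟙 (newFace T S)))
        ≤⟨ ∑-mono n faces≤ ⟩
      ∑ n (λ T → 𝟙 (∣ T ∣ ≡ᵇ j) * (M * (k * binomial (j + suc K) K)))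
        ≡⟨ ∑-*ʳ n _ _ ⟩
      ∑ n (λ T → 𝟙 (∣ T ∣ ≡ᵇ j)) * (M * (k * binomial (j + suc K) K))
        ≡⟨ cong (_* (M * (k * binomial (j + suc K) K))) (∑-size n j) ⟩
      binomial n j * (M * (k * binomial (j + suc K) K)) ∎
      where
      open ≤-Reasoning
      *-comm-right : ∀ a b c → a * b * c ≡ a * c * b
      *-comm-right a b c = trans (*-assoc a b c) (trans (cong (a *_) (*-comm b c)) (sym (*-assoc a c b)))
      completions : ∀ T S → ∑ n (λ u → 𝟙 (candidate j T) * 𝟙 (newFace T S) * completesNonEdge u S)
                          ≡ 𝟙 (candidate j T) * 𝟙 (newFace T S) * missing S
      completions T S = trans (∑-*ˡ n (𝟙 (candidate j T) * 𝟙 (newFace T S)) (λ u → completesNonEdge u S))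
        (cong (𝟙 (candidate j T) * 𝟙 (newFace T S) *_) (sym (∑-⊇≡∑-∪ n S (λ f → 𝟙 (nonEdge f)))))
      missing≤M-on-faces : ∀ T S → 𝟙 (candidate j T) * 𝟙 (newFace T S) * missing S
                                 ≤ 𝟙 (candidate j T) * 𝟙 (newFace T S) * M
      missing≤M-on-faces T S with newFace T S in S-face
      ... | false = ≤-reflexive (trans (cong (_* missing S) c*0≡0) (sym (cong (_* M) c*0≡0)))
        where c*0≡0 = *-zeroʳ (𝟙 (candidate j T))
      ... | true  = *-monoʳ-≤ (𝟙 (candidate j T) * 1) (missing≤M S (proj₁ (newFace⇒ T S S-face)))
      faces≤ : ∀ T → 𝟙 (candidate j T) * M * ∑ n (λ S → 𝟙 (newFace T S))
                   ≤ 𝟙 (∣ T ∣ ≡ᵇ j) * (M * (k * binomial (j + suc K) K))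
      faces≤ T with ∣ T ∣ ≡ᵇ j in ∣T∣≡j | disjointᵇ T e in T#e
      ... | false | _     = z≤n
      ... | true  | false = z≤n
      ... | true  | true  = begin
        1 * M * ∑ n (λ S → 𝟙 (newFace T S))
          ≡⟨ *-assoc 1 M _ ⟩
        1 * (M * ∑ n (λ S → 𝟙 (newFace T S)))
          ≤⟨ *-monoʳ-≤ 1 (*-monoʳ-≤ M (∑-newFace≤ j T (≡ᵇ⇒≡′ ∣T∣≡j) T#e)) ⟩
        1 * (M * (k * binomial (j + suc K) K)) ∎

    -- Double count the pairs (u, T) with u ∈ T and T a spoilt candidate of size j + 1.
    spoiltCount-step : ∀ j →
      suc j * spoiltCount (suc j) ≤ n * spoiltCount j + binomial n j * (M * (k * binomial (j + suc K) K))
    spoiltCount-step j = begin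
      suc j * spoiltCount (suc j)
        ≡⟨ ∑-*ˡ n (suc j) _ ⟨
      ∑ n (λ T → suc j * 𝟙 (spoilt′ (suc j) T))
        ≡⟨ ∑-cong n points ⟩
      ∑ n (λ T → ∑ n (λ u → 𝟙 ((u ⊆ᵇ T) ∧ (∣ u ∣ ≡ᵇ 1)) * 𝟙 (spoilt′ (suc j) T)))
        ≡⟨ ∑-swap n n _ ⟩
      ∑ n (λ u → ∑ n (λ T → 𝟙 ((u ⊆ᵇ T) ∧ (∣ u ∣ ≡ᵇ 1)) * 𝟙 (spoilt′ (suc j) T)))
        ≡⟨ ∑-cong n factor ⟩
      ∑ n (λ u → 𝟙 (∣ u ∣ ≡ᵇ 1) * ∑ n (λ T → 𝟙 (u ⊆ᵇ T) * 𝟙 (spoilt′ (suc j) T)))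
        ≡⟨ ∑-cong n (λ u → cong (𝟙 (∣ u ∣ ≡ᵇ 1) *_) (∑-⊇≡∑-∪ n u (λ T → 𝟙 (spoilt′ (suc j) T)))) ⟩
      ∑ n (λ u → 𝟙 (∣ u ∣ ≡ᵇ 1) * ∑ n (λ T → 𝟙 (disjointᵇ T u) * 𝟙 (spoilt′ (suc j) (T ∪ u))))
        ≡⟨ ∑-cong n (λ u → ∑-*ˡ n (𝟙 (∣ u ∣ ≡ᵇ 1)) _) ⟨
      ∑ n (λ u → ∑ n (λ T → 𝟙 (∣ u ∣ ≡ᵇ 1) * (𝟙 (disjointᵇ T u) * 𝟙 (spoilt′ (suc j) (T ∪ u)))))
        ≤⟨ ∑-mono n (λ u → ∑-mono n (λ T → spoilt-extension j u T)) ⟩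
      ∑ n (λ u → ∑ n (λ T → 𝟙 (∣ u ∣ ≡ᵇ 1) * 𝟙 (spoilt′ j T) + new u T))
        ≡⟨ ∑-cong n (λ u → ∑-+ n _ _) ⟩
      ∑ n (λ u → ∑ n (λ T → 𝟙 (∣ u ∣ ≡ᵇ 1) * 𝟙 (spoilt′ j T)) + ∑ n (λ T → new u T))
        ≡⟨ ∑-+ n _ _ ⟩
      ∑ n (λ u → ∑ n (λ T → 𝟙 (∣ u ∣ ≡ᵇ 1) * 𝟙 (spoilt′ j T))) + ∑ n (λ u → ∑ n (λ T → new u T))
        ≤⟨ +-mono-≤ (≤-reflexive old) (∑-newNonEdges≤ j) ⟩
      n * spoiltCount j + binomial n j * (M * (k * binomial (j + suc K) K)) ∎
      where
      open ≤-Reasoning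
      spoilt′ : ℕ → Subset n → Bool
      spoilt′ i T = candidate i T ∧ spoilt T
      new : Subset n → Subset n → ℕ
      new u T = ∑ n (λ S → 𝟙 (candidate j T) * 𝟙 (newFace T S) * completesNonEdge u S)
      points : ∀ T → suc j * 𝟙 (spoilt′ (suc j) T) ≡ ∑ n (λ u → 𝟙 ((u ⊆ᵇ T) ∧ (∣ u ∣ ≡ᵇ 1)) * 𝟙 (spoilt′ (suc j) T))
      points T with spoilt′ (suc j) T in T-spoilt
      ... | false = trans (*-zeroʳ (suc j)) (sym (∑-zero n (λ u → *-zeroʳ (𝟙 ((u ⊆ᵇ T) ∧ (∣ u ∣ ≡ᵇ 1))))))
      ... | true  = begin-equality
        suc j * 1                                    ≡⟨ *-identityʳ (suc j) ⟩
        suc j                                        ≡⟨ ≡ᵇ⇒≡′ (∧-trueˡ (∧-trueˡ T-spoilt)) ⟨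
        ∣ T ∣                                        ≡⟨ binomial-n-1 ∣ T ∣ ⟨
        binomial ∣ T ∣ 1                             ≡⟨ ∑-subsets n T 1 ⟨
        ∑ n (λ u → 𝟙 ((u ⊆ᵇ T) ∧ (∣ u ∣ ≡ᵇ 1)))     ≡⟨ ∑-cong n (λ u → *-identityʳ _) ⟨
        ∑ n (λ u → 𝟙 ((u ⊆ᵇ T) ∧ (∣ u ∣ ≡ᵇ 1)) * 1) ∎
      factor : ∀ u → ∑ n (λ T → 𝟙 ((u ⊆ᵇ T) ∧ (∣ u ∣ ≡ᵇ 1)) * 𝟙 (spoilt′ (suc j) T))
                   ≡ 𝟙 (∣ u ∣ ≡ᵇ 1) * ∑ n (λ T → 𝟙 (u ⊆ᵇ T) * 𝟙 (spoilt′ (suc j) T))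
      factor u = trans (∑-cong n (λ T → trans (cong (_* 𝟙 (spoilt′ (suc j) T)) (𝟙-∧ (u ⊆ᵇ T) (∣ u ∣ ≡ᵇ 1)))
                                              (*-comm-left (𝟙 (u ⊆ᵇ T)) (𝟙 (∣ u ∣ ≡ᵇ 1)) _)))
                       (∑-*ˡ n (𝟙 (∣ u ∣ ≡ᵇ 1)) _)
        where
        *-comm-left : ∀ a b c → a * b * c ≡ b * (a * c)
        *-comm-left a b c = trans (cong (_* c) (*-comm a b)) (*-assoc b a c)
      old : ∑ n (λ u → ∑ n (λ T → 𝟙 (∣ u ∣ ≡ᵇ 1) * 𝟙 (spoilt′ j T))) ≡ n * spoiltCount j
      old = begin-equality
        ∑ n (λ u → ∑ n (λ T → 𝟙 (∣ u ∣ ≡ᵇ 1) * 𝟙 (spoilt′ j T)))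
          ≡⟨ ∑-cong n (λ u → ∑-*ˡ n (𝟙 (∣ u ∣ ≡ᵇ 1)) _) ⟩
        ∑ n (λ u → 𝟙 (∣ u ∣ ≡ᵇ 1) * spoiltCount j)
          ≡⟨ ∑-*ʳ n _ _ ⟩
        ∑ n (λ u → 𝟙 (∣ u ∣ ≡ᵇ 1)) * spoiltCount j
          ≡⟨ cong (_* spoiltCount j) (trans (∑-size n 1) (binomial-n-1 n)) ⟩
        n * spoiltCount j ∎

    spoiltCount-bound : ∀ j → spoiltCount j * j ! * n ≤ M * n ^ j * k * (binomial (j + suc K) (suc K) ∸ 1)
    spoiltCount-bound zero rewrite spoiltCount-0 = z≤n
    spoiltCount-bound (suc j) = begin
      spoiltCount (suc j) * (suc j * j !) * n
        ≡⟨ solve 4 (λ B s f m → B :* (s :* f) :* m := s :* B :* f :* m) refl (spoiltCount (suc j)) (suc j) (j !) n ⟩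
      suc j * spoiltCount (suc j) * j ! * n
        ≤⟨ *-monoˡ-≤ n (*-monoˡ-≤ (j !) (spoiltCount-step j)) ⟩
      (n * spoiltCount j + binomial n j * (M * (k * c))) * j ! * n
        ≡⟨ solve 7 (λ m b bn M k c f → (m :* b :+ bn :* (M :* (k :* c))) :* f :* m
                                    := m :* (b :* f :* m) :+ (bn :* f) :* (M :* k :* c :* m))
                   refl n (spoiltCount j) (binomial n j) M k c (j !) ⟩
      n * (spoiltCount j * j ! * n) + binomial n j * j ! * (M * k * c * n)
        ≤⟨ +-mono-≤ (*-monoʳ-≤ n (spoiltCount-bound j)) (*-monoˡ-≤ (M * k * c * n) (binomial*!≤^ n j)) ⟩
      n * (M * n ^ j * k * (d ∸ 1)) + n ^ j * (M * k * c * n)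
        ≡⟨ solve 6 (λ m M p k D c → m :* (M :* p :* k :* D) :+ p :* (M :* k :* c :* m)
                                 := M :* (m :* p) :* k :* (D :+ c))
                   refl n M (n ^ j) k (d ∸ 1) c ⟩
      M * (n * n ^ j) * k * ((d ∸ 1) + c)
        ≡⟨ cong (M * (n * n ^ j) * k *_) pascal ⟩
      M * (n * n ^ j) * k * (binomial (suc j + suc K) (suc K) ∸ 1) ∎
      where
      open ≤-Reasoning
      open ℕ-Solver.+-*-Solver
      c = binomial (j + suc K) K
      d = binomial (j + suc K) (suc K)
      pascal : (d ∸ 1) + c ≡ binomial (suc j + suc K) (suc K) ∸ 1
      pascal = trans (+-comm (d ∸ 1) c) (sym (+-∸-assoc c (binomial-pos (m≤n+m (suc K) j))))

    cliqueCount-gap : ∀ r m → r ∸ k ≡ suc m → k ≤ r →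
      cliqueCount G (suc m) * (suc m ! * n)
        ≤ cliquesContaining G r e * (suc m ! * n)
          + (k * suc m * n ^ suc m + M * n ^ suc m * k * (binomial (suc m + suc K) (suc K) ∸ 1))
    cliqueCount-gap r m r∸k≡1+m k≤r = begin
      cliqueCount G (suc m) * P
        ≤⟨ *-monoˡ-≤ P (subst (λ i → cliqueCount G i ≤ κ + (meetingCount i + spoiltCount i))
                              r∸k≡1+m (cliqueCount≤cliquesContaining+ r k≤r)) ⟩
      (κ + (meetingCount (suc m) + spoiltCount (suc m))) * P
        ≡⟨ solve 4 (λ a b c p → (a :+ (b :+ c)) :* p := a :* p :+ (b :* p :+ c :* p))
                   refl κ (meetingCount (suc m)) (spoiltCount (suc m)) P ⟩
      κ * P + (meetingCount (suc m) * P + spoiltCount (suc m) * P)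
        ≤⟨ +-monoʳ-≤ (κ * P) (+-mono-≤ meeting-bound spoilt-bound) ⟩
      κ * P + (k * suc m * n ^ suc m + M * n ^ suc m * k * (binomial (suc m + suc K) (suc K) ∸ 1)) ∎
      where
      open ≤-Reasoning
      open ℕ-Solver.+-*-Solver
      κ = cliquesContaining G r e
      P = suc m ! * n
      spoilt-bound : spoiltCount (suc m) * P ≤ M * n ^ suc m * k * (binomial (suc m + suc K) (suc K) ∸ 1)
      spoilt-bound = ≤-trans (≤-reflexive (sym (*-assoc (spoiltCount (suc m)) (suc m !) n))) (spoiltCount-bound (suc m))
      meeting-bound : meetingCount (suc m) * P ≤ k * suc m * n ^ suc m
      meeting-bound = begin
        meetingCount (suc m) * (suc m * m ! * n)
          ≤⟨ *-monoˡ-≤ (suc m * m ! * n) (meetingCount≤ m) ⟩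
        k * binomial (n ∸ 1) m * (suc m * m ! * n)
          ≡⟨ solve 5 (λ k b s f x → k :* b :* (s :* f :* x) := k :* s :* (b :* f) :* x)
                     refl k (binomial (n ∸ 1) m) (suc m) (m !) n ⟩
        k * suc m * (binomial (n ∸ 1) m * m !) * n
          ≤⟨ *-monoˡ-≤ n (*-monoʳ-≤ (k * suc m) (≤-trans (binomial*!≤^ (n ∸ 1) m) (^-monoˡ-≤ m (m∸n≤m n 1)))) ⟩
        k * suc m * n ^ m * n
          ≡⟨ solve 3 (λ a p x → a :* p :* x := a :* (x :* p)) refl (k * suc m) (n ^ m) n ⟩
        k * suc m * (n * n ^ m) ∎

-- Passing to the rationals

-- Opaque copies of ℕ→ℚ and _/!_, so that the typechecker never tries to run the normalisation inside them.
opaque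
  ι : ℕ → ℚ
  ι = ℕ→ℚ

  ι≡ℕ→ℚ : ι ≡ ℕ→ℚ
  ι≡ℕ→ℚ = refl

  _÷!_ : ℕ → ℕ → ℚ
  _÷!_ = _/!_

  ÷!≡/! : _÷!_ ≡ _/!_
  ÷!≡/! = refl

  private
    toℚᵘ-ι : ∀ a → toℚᵘ (ι a) ≡ ℚᵘ.mkℚᵘ (ℤ.+ a) 0
    toℚᵘ-ι a = cong toℚᵘ (ℚ.normalize-coprime (λ p → ∣1⇒≡1 (proj₂ p)))

    ≃-mkℚᵘ : ∀ {x y : ℤ} → x ≡ y → ℚᵘ.mkℚᵘ x 0 ℚᵘ.≃ ℚᵘ.mkℚᵘ y 0
    ≃-mkℚᵘ x≡y = ℚᵘ.*≡* (cong (ℤ._* ℤ.+ 1) x≡y)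

  ι-0 : ι 0 ≡ 0ℚ
  ι-0 = refl

  ι-+ : ∀ a b → ι (a + b) ≡ ι a +ℚ ι b
  ι-+ a b = ℚ.toℚᵘ-injective (ℚᵘ.≃-trans lhs (ℚᵘ.≃-sym (ℚ.toℚᵘ-homo-+ (ι a) (ι b))))
    where
    lhs : toℚᵘ (ι (a + b)) ℚᵘ.≃ (toℚᵘ (ι a) ℚᵘ.+ toℚᵘ (ι b))
    lhs rewrite toℚᵘ-ι (a + b) | toℚᵘ-ι a | toℚᵘ-ι b =
      ≃-mkℚᵘ (trans (ℤ.pos-+ a b) (sym (cong₂ ℤ._+_ (ℤ.*-identityʳ (ℤ.+ a)) (ℤ.*-identityʳ (ℤ.+ b)))))

  ι-* : ∀ a b → ι (a * b) ≡ ι a *ℚ ι b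
  ι-* a b = ℚ.toℚᵘ-injective (ℚᵘ.≃-trans lhs (ℚᵘ.≃-sym (ℚ.toℚᵘ-homo-* (ι a) (ι b))))
    where
    lhs : toℚᵘ (ι (a * b)) ℚᵘ.≃ (toℚᵘ (ι a) ℚᵘ.* toℚᵘ (ι b))
    lhs rewrite toℚᵘ-ι (a * b) | toℚᵘ-ι a | toℚᵘ-ι b = ≃-mkℚᵘ (ℤ.pos-* a b)

  ι-mono-≤ : ∀ {a b} → a ≤ b → ι a ≤ℚ ι b
  ι-mono-≤ {a} {b} a≤b = ℚ.toℚᵘ-cancel-≤ lhs
    where
    lhs : toℚᵘ (ι a) ℚᵘ.≤ toℚᵘ (ι b)
    lhs rewrite toℚᵘ-ι a | toℚᵘ-ι b =
      ℚᵘ.*≤* (subst₂ ℤ._≤_ (sym (ℤ.*-identityʳ (ℤ.+ a))) (sym (ℤ.*-identityʳ (ℤ.+ b))) (ℤ.+≤+ a≤b))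

  ι-positive : ∀ d → Positive (ι (suc d))
  ι-positive d = subst ℚᵘ.Positive (sym (toℚᵘ-ι (suc d))) (ℤ.positive (ℤ.+<+ (s≤s z≤n)))

  ÷!*! : ∀ a m → (a ÷! m) *ℚ ι (m !) ≡ ι a
  ÷!*! a m = lemma a (m !) {{m !≢0}}
    where
    lemma : ∀ a d .{{_ : NonZero d}} → (ℤ.+ a / d) *ℚ ι d ≡ ι a
    lemma a (suc d) = ℚ.toℚᵘ-injective (ℚᵘ.≃-trans (ℚ.toℚᵘ-homo-* (ℤ.+ a / suc d) (ι (suc d))) h)
      where
      h : (toℚᵘ (ℤ.+ a / suc d) ℚᵘ.* toℚᵘ (ι (suc d))) ℚᵘ.≃ toℚᵘ (ι a)
      h rewrite toℚᵘ-ι (suc d) | toℚᵘ-ι a =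
        ℚᵘ.≃-trans (ℚᵘ.*-congʳ (ℚ.toℚᵘ-fromℚᵘ (ℚᵘ.mkℚᵘ (ℤ.+ a) d)))
          (ℚᵘ.*≡* (trans (ℤ.*-identityʳ _) (trans (sym (ℤ.pos-* a (suc d)))
            (trans (cong (λ x → ℤ.+ (a * x)) (cong suc (sym (*-identityʳ d)))) (ℤ.pos-* a _)))))

0≤ι : ∀ a → 0ℚ ≤ℚ ι a
0≤ι a = subst (_≤ℚ ι a) ι-0 (ι-mono-≤ z≤n)

ι-cancelʳ-≤ : ∀ {x y} a → 1 ≤ a → x *ℚ ι a ≤ℚ y *ℚ ι a → x ≤ℚ y
ι-cancelʳ-≤ (suc a) _ = ℚ.*-cancelʳ-≤-pos (ι (suc a)) {{ι-positive a}}

*-monoˡ-≤-nonNeg : ∀ c {a b} → 0ℚ ≤ℚ c → a ≤ℚ b → c *ℚ a ≤ℚ c *ℚ b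
*-monoˡ-≤-nonNeg c 0≤c = ℚ.*-monoˡ-≤-nonNeg c {{nonNegative 0≤c}}

*-monoʳ-≤-nonNeg : ∀ c {a b} → 0ℚ ≤ℚ c → a ≤ℚ b → a *ℚ c ≤ℚ b *ℚ c
*-monoʳ-≤-nonNeg c 0≤c = ℚ.*-monoʳ-≤-nonNeg c {{nonNegative 0≤c}}

0≤* : ∀ {x y} → 0ℚ ≤ℚ x → 0ℚ ≤ℚ y → 0ℚ ≤ℚ x *ℚ y
0≤* {x} {y} 0≤x 0≤y = ℚ.≤-trans (ℚ.≤-reflexive (sym (ℚ.*-zeroˡ y))) (*-monoʳ-≤-nonNeg y 0≤y 0≤x)

-‿monoʳ-≤ : ∀ c {a b} → a ≤ℚ b → c -ℚ b ≤ℚ c -ℚ a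
-‿monoʳ-≤ c a≤b = ℚ.+-monoʳ-≤ c (ℚ.neg-antimono-≤ a≤b)

x≤y+z⇒x-z≤y : ∀ {x y} z → x ≤ℚ y +ℚ z → x -ℚ z ≤ℚ y
x≤y+z⇒x-z≤y {x} {y} z x≤y+z =
  ℚ.≤-trans (ℚ.+-monoˡ-≤ (-ℚ z) x≤y+z) (ℚ.≤-reflexive (solve 2 (λ y z → y :+ z :- z := y) refl y z))
  where open ℚ-Solver.+-*-Solver

C≤^÷! : ∀ n r → ι (n C r) ≤ℚ (n ^ r) ÷! r
C≤^÷! n r rewrite sym (binomial≡C n r) = ι-cancelʳ-≤ (r !) (1≤n! r) (begin
  ι (binomial n r) *ℚ ι (r !)   ≡⟨ ι-* (binomial n r) (r !) ⟨
  ι (binomial n r * r !)        ≤⟨ ι-mono-≤ (binomial*!≤^ n r) ⟩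
  ι (n ^ r)                     ≡⟨ ÷!*! (n ^ r) r ⟨
  (n ^ r) ÷! r *ℚ ι (r !)       ∎)
  where open ℚ.≤-Reasoning

-- Parametrised by the embedding of ℕ and the division by factorials, so that it can be transported
-- from the opaque copies.
Bounds : (ℕ → ℚ) → (ℕ → ℕ → ℚ) → ∀ {k n} → Hypergraph k n → ℕ → ℚ → Set
Bounds ι′ _÷′_ {k} {n} G r δ =
  ((1ℚ -ℚ ι′ (r C k) *ℚ δ) *ℚ ι′ (n C r) ≤ℚ ι′ (cliqueCount G r)
    × cliqueCount G r ≤ n C r
    × ι′ (n C r) ≤ℚ (n ^ r) ÷′ r)
  × (∀ (e : Subset n) → isEdge G e ≡ true →
      (ι′ (cliqueCount G (r ∸ k))
         -ℚ ι′ (2 * k) *ℚ δ *ℚ ((n ^ (r ∸ k)) ÷′ (r ∸ k)) *ℚ ι′ (r C (k ∸ 1))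
         ≤ℚ ι′ (cliquesContaining G r e))
      × cliquesContaining G r e ≤ cliqueCount G (r ∸ k))

module _ {K n : ℕ} (G : Hypergraph (suc (suc K)) n) (δ : ℚ) (1<nδ : 1ℚ <ℚ ι n *ℚ δ) (δ<1 : δ <ℚ 1ℚ)
         (codegree≥ : ∀ S → ∣ S ∣ ≡ suc K → (1ℚ -ℚ δ) *ℚ ι n ≤ℚ ι (codegree G S)) where
  open Cliques G

  private
    k : ℕ
    k = suc (suc K)

    1≮0 : ¬ (1ℚ <ℚ 0ℚ)
    1≮0 (*<* (ℤ.+<+ ()))

  0≤δ : 0ℚ ≤ℚ δ
  0≤δ with ℚ.≤-total 0ℚ δ
  ... | inj₁ 0≤δ = 0≤δ
  ... | inj₂ δ≤0 = ⊥-elim (1≮0 (ℚ.<-≤-trans 1<nδ (begin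
    ι n *ℚ δ   ≤⟨ *-monoˡ-≤-nonNeg (ι n) (0≤ι n) δ≤0 ⟩
    ι n *ℚ 0ℚ  ≡⟨ ℚ.*-zeroʳ (ι n) ⟩
    0ℚ         ∎)))
    where open ℚ.≤-Reasoning

  1≤n : 1 ≤ n
  1≤n = n≢0⇒n>0 λ n≡0 → 1≮0 (subst (1ℚ <ℚ_) (nδ≡0 n≡0) 1<nδ)
    where
    nδ≡0 : n ≡ 0 → ι n *ℚ δ ≡ 0ℚ
    nδ≡0 refl = trans (cong (_*ℚ δ) ι-0) (ℚ.*-zeroˡ δ)

  -- The codegree condition says that at most δ n of the n - (k-1) extensions of a (k-1)-set are non-edges.
  missing≤ : ∀ S → ∣ S ∣ ≡ suc K → ι (missing S) ≤ℚ δ *ℚ ι (n ∸ suc K)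
  missing≤ S ∣S∣≡1+K = begin
    ι (missing S)                    ≡⟨ missing≡ ⟩
    a -ℚ c                           ≤⟨ -‿monoʳ-≤ a (subst (λ x → (1ℚ -ℚ δ) *ℚ x ≤ℚ c) ι-n (codegree≥ S ∣S∣≡1+K)) ⟩
    a -ℚ (1ℚ -ℚ δ) *ℚ (a +ℚ b)       ≡⟨ solve 3 (λ a b d → a :- (con 1ℚ :- d) :* (a :+ b) := d :* a :- (con 1ℚ :- d) :* b)
                                             refl a b δ ⟩
    δ *ℚ a -ℚ (1ℚ -ℚ δ) *ℚ b         ≤⟨ -‿monoʳ-≤ (δ *ℚ a) (0≤* 0≤1-δ (0≤ι (suc K))) ⟩
    δ *ℚ a -ℚ 0ℚ                     ≡⟨ ℚ.+-identityʳ (δ *ℚ a) ⟩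
    δ *ℚ a                           ∎
    where
    open ℚ.≤-Reasoning
    open ℚ-Solver.+-*-Solver
    a = ι (n ∸ suc K)
    b = ι (suc K)
    c = ι (codegree G S)
    missing≡ : ι (missing S) ≡ a -ℚ c
    missing≡ = begin-equality
      ι (missing S)                                 ≡⟨ solve 2 (λ x y → x := (x :+ y) :- y) refl (ι (missing S)) c ⟩
      (ι (missing S) +ℚ c) -ℚ c                     ≡⟨ cong (_-ℚ c) (ι-+ (missing S) (codegree G S)) ⟨
      ι (missing S + codegree G S) -ℚ c             ≡⟨ cong (λ x → ι x -ℚ c) (missing+codegree G S ∣S∣≡1+K) ⟩
      a -ℚ c                                        ∎
    ι-n : ι n ≡ a +ℚ b
    ι-n = trans (cong ι (sym (m∸n+n≡m (subst (_≤ n) ∣S∣≡1+K (∣p∣≤n S))))) (ι-+ (n ∸ suc K) (suc K))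
    0≤1-δ : 0ℚ ≤ℚ 1ℚ -ℚ δ
    0≤1-δ = ℚ.≤-trans (ℚ.≤-reflexive (sym (ℚ.+-inverseʳ δ))) (ℚ.+-monoˡ-≤ (-ℚ δ) (ℚ.<⇒≤ δ<1))

  maxMissing : ℕ
  maxMissing = ⨆ n (λ S → 𝟙 (∣ S ∣ ≡ᵇ suc K) * missing S)

  missing≤maxMissing : ∀ S → ∣ S ∣ ≡ suc K → missing S ≤ maxMissing
  missing≤maxMissing S ∣S∣≡1+K =
    subst (_≤ maxMissing) (trans (cong (λ b → 𝟙 b * missing S) (≡⇒≡ᵇ′ ∣S∣≡1+K)) (+-identityʳ _)) (term≤⨆ n _ S)

  maxMissing≤ : ι maxMissing ≤ℚ δ *ℚ ι (n ∸ suc K)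
  maxMissing≤ with ⨆-attained n (λ S → 𝟙 (∣ S ∣ ≡ᵇ suc K) * missing S)
  ... | S , max≡ with ∣ S ∣ ≡ᵇ suc K in ∣S∣≡1+K
  ...   | true  = subst (λ m → ι m ≤ℚ δ *ℚ ι (n ∸ suc K)) (sym (trans max≡ (+-identityʳ _))) (missing≤ S (≡ᵇ⇒≡′ ∣S∣≡1+K))
  ...   | false = subst (λ m → ι m ≤ℚ δ *ℚ ι (n ∸ suc K)) (sym max≡) (subst (_≤ℚ δ *ℚ ι (n ∸ suc K)) (sym ι-0) (0≤* 0≤δ (0≤ι (n ∸ suc K))))

  nonCliqueCount≤ℚ : ∀ r → k ≤ r → ι (nonCliqueCount r) ≤ℚ δ *ℚ ι (binomial r k) *ℚ ι (binomial n r)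
  nonCliqueCount≤ℚ r k≤r = ι-cancelʳ-≤ k (s≤s z≤n) (begin
    ι (nonCliqueCount r) *ℚ ι k
      ≡⟨ trans (ℚ.*-comm (ι (nonCliqueCount r)) (ι k)) (sym (ι-* k (nonCliqueCount r))) ⟩
    ι (k * nonCliqueCount r)
      ≤⟨ ι-mono-≤ nonCliques≤ ⟩
    ι (binomial n (suc K) * maxMissing * b)
      ≡⟨ trans (ι-* (binomial n (suc K) * maxMissing) b) (cong (_*ℚ ι b) (ι-* (binomial n (suc K)) maxMissing)) ⟩
    ι (binomial n (suc K)) *ℚ ι maxMissing *ℚ ι b
      ≤⟨ *-monoʳ-≤-nonNeg (ι b) (0≤ι b) (*-monoˡ-≤-nonNeg (ι (binomial n (suc K))) (0≤ι _) maxMissing≤) ⟩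
    ι (binomial n (suc K)) *ℚ (δ *ℚ ι (n ∸ suc K)) *ℚ ι b
      ≡⟨ solve 4 (λ x d y z → x :* (d :* y) :* z := d :* (x :* y :* z)) refl
                 (ι (binomial n (suc K))) δ (ι (n ∸ suc K)) (ι b) ⟩
    δ *ℚ (ι (binomial n (suc K)) *ℚ ι (n ∸ suc K) *ℚ ι b)
      ≡⟨ cong (δ *ℚ_) (trans (ι-* (binomial n (suc K) * (n ∸ suc K)) b)
                             (cong (_*ℚ ι b) (ι-* (binomial n (suc K)) (n ∸ suc K)))) ⟨
    δ *ℚ ι (binomial n (suc K) * (n ∸ suc K) * b)
      ≡⟨ cong (λ x → δ *ℚ ι x) (binomial-*-∸-*-binomial n (suc K) r k≤r) ⟩
    δ *ℚ ι (k * (binomial n r * binomial r k))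
      ≡⟨ cong (δ *ℚ_) (trans (ι-* k (binomial n r * binomial r k)) (cong (ι k *ℚ_) (ι-* (binomial n r) (binomial r k)))) ⟩
    δ *ℚ (ι k *ℚ (ι (binomial n r) *ℚ ι (binomial r k)))
      ≡⟨ solve 4 (λ d a b c → d :* (a :* (b :* c)) := d :* c :* b :* a) refl δ (ι k) (ι (binomial n r)) (ι (binomial r k)) ⟩
    δ *ℚ ι (binomial r k) *ℚ ι (binomial n r) *ℚ ι k ∎)
    where
    open ℚ.≤-Reasoning
    open ℚ-Solver.+-*-Solver
    b = binomial (n ∸ k) (r ∸ k)
    nonCliques≤ : k * nonCliqueCount r ≤ binomial n (suc K) * maxMissing * b
    nonCliques≤ = ≤-trans (*-monoʳ-≤ k (nonCliqueCount≤ r k≤r))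
                    (≤-trans (≤-reflexive (sym (*-assoc k nonEdgeCount b)))
                             (*-monoˡ-≤ b (k*nonEdgeCount≤ G maxMissing missing≤maxMissing)))

  cliqueCount≥ : ∀ r → k ≤ r → (1ℚ -ℚ ι (r C k) *ℚ δ) *ℚ ι (n C r) ≤ℚ ι (cliqueCount G r)
  cliqueCount≥ r k≤r rewrite sym (binomial≡C r k) | sym (binomial≡C n r) = begin
    (1ℚ -ℚ ι (binomial r k) *ℚ δ) *ℚ ι (binomial n r)
      ≡⟨ solve 3 (λ a d b → (con 1ℚ :- a :* d) :* b := b :- d :* a :* b) refl (ι (binomial r k)) δ (ι (binomial n r)) ⟩
    ι (binomial n r) -ℚ δ *ℚ ι (binomial r k) *ℚ ι (binomial n r)
      ≤⟨ -‿monoʳ-≤ (ι (binomial n r)) (nonCliqueCount≤ℚ r k≤r) ⟩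
    ι (binomial n r) -ℚ ι (nonCliqueCount r)
      ≡⟨ cong (_-ℚ ι (nonCliqueCount r)) (trans (cong ι (sym (cliqueCount+nonCliqueCount r)))
                                               (ι-+ (cliqueCount G r) (nonCliqueCount r))) ⟩
    ι (cliqueCount G r) +ℚ ι (nonCliqueCount r) -ℚ ι (nonCliqueCount r)
      ≡⟨ solve 2 (λ x y → x :+ y :- y := x) refl (ι (cliqueCount G r)) (ι (nonCliqueCount r)) ⟩
    ι (cliqueCount G r) ∎
    where
    open ℚ.≤-Reasoning
    open ℚ-Solver.+-*-Solver

  module _ (e : Subset n) (e∈G : isEdge G e ≡ true) (r : ℕ) (k<r : k < r) where

    private
      m = r ∸ suc k
      r∸k≡1+m : r ∸ k ≡ suc m
      r∸k≡1+m = +-∸-assoc 1 k<r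
      k≤r = <⇒≤ k<r
      P = suc m ! * n
      p = n ^ suc m
      B = binomial (suc m + suc K) (suc K)
      Cr = binomial r (suc K)
      A₁ = k * suc m * p
      A₂ = maxMissing * p * k * (B ∸ 1)

    A₁+≡ : A₁ + p * k * (B ∸ 1) ≡ p * k * (suc m + (B ∸ 1))
    A₁+≡ = solve 4 (λ k s p b → k :* s :* p :+ p :* k :* b := p :* k :* (s :+ b)) refl k (suc m) p (B ∸ 1)
      where open ℕ-Solver.+-*-Solver

    errorFactor≤ : suc m + (B ∸ 1) ≤ 2 * Cr
    errorFactor≤ = begin
      suc m + (B ∸ 1) ≤⟨ +-mono-≤ 1+m≤Cr (≤-trans (m∸n≤m B 1) B≤Cr) ⟩
      Cr + Cr         ≡⟨ cong (Cr +_) (+-identityʳ Cr) ⟨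
      2 * Cr          ∎
      where
      open ≤-Reasoning
      r≡ : r ≡ suc (suc m + suc K)
      r≡ = trans (sym (m∸n+n≡m k≤r)) (trans (cong (_+ k) r∸k≡1+m) (+-suc (suc m) (suc K)))
      B≤Cr : B ≤ Cr
      B≤Cr = subst (λ x → B ≤ binomial x (suc K)) (sym r≡) (m≤n+m B (binomial (suc m + suc K) K))
      1+m≤Cr : suc m ≤ Cr
      1+m≤Cr = ≤-trans (subst (_≤ r) r∸k≡1+m (m∸n≤m r k))
                       (≤binomial r (suc K) (s≤s z≤n) (subst (suc K <_) (sym r≡) (s≤s (m≤n+m (suc K) (suc m)))))

    error≤ : ι (A₁ + A₂) ≤ℚ δ *ℚ ι n *ℚ ι (p * k * (2 * Cr))
    error≤ = begin
      ι (A₁ + A₂)                                     ≡⟨ ι-+ A₁ A₂ ⟩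
      ι A₁ +ℚ ι A₂                                    ≤⟨ ℚ.+-mono-≤ A₁≤ A₂≤ ⟩
      δn *ℚ ι A₁ +ℚ δn *ℚ ι (p * k * (B ∸ 1))         ≡⟨ ℚ.*-distribˡ-+ δn (ι A₁) _ ⟨
      δn *ℚ (ι A₁ +ℚ ι (p * k * (B ∸ 1)))             ≡⟨ cong (δn *ℚ_) (trans (cong ι (sym A₁+≡)) (ι-+ A₁ _)) ⟨
      δn *ℚ ι (p * k * (suc m + (B ∸ 1)))             ≤⟨ *-monoˡ-≤-nonNeg δn (0≤* 0≤δ (0≤ι n))
                                                           (ι-mono-≤ (*-monoʳ-≤ (p * k) errorFactor≤)) ⟩
      δn *ℚ ι (p * k * (2 * Cr))                      ∎
      where
      open ℚ.≤-Reasoning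
      open ℚ-Solver.+-*-Solver
      δn = δ *ℚ ι n
      A₁≤ : ι A₁ ≤ℚ δn *ℚ ι A₁
      A₁≤ = begin
        ι A₁                  ≡⟨ ℚ.*-identityʳ (ι A₁) ⟨
        ι A₁ *ℚ 1ℚ            ≤⟨ *-monoˡ-≤-nonNeg (ι A₁) (0≤ι A₁) (ℚ.<⇒≤ 1<nδ) ⟩
        ι A₁ *ℚ (ι n *ℚ δ)    ≡⟨ solve 3 (λ a x d → a :* (x :* d) := d :* x :* a) refl (ι A₁) (ι n) δ ⟩
        δn *ℚ ι A₁            ∎
      A₂≤ : ι A₂ ≤ℚ δn *ℚ ι (p * k * (B ∸ 1))
      A₂≤ = begin
        ι A₂
          ≡⟨ cong ι (*-assoc-4 maxMissing p k (B ∸ 1)) ⟩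
        ι (maxMissing * (p * k * (B ∸ 1)))
          ≡⟨ ι-* maxMissing _ ⟩
        ι maxMissing *ℚ ι (p * k * (B ∸ 1))
          ≤⟨ *-monoʳ-≤-nonNeg (ι (p * k * (B ∸ 1))) (0≤ι _)
               (ℚ.≤-trans maxMissing≤ (*-monoˡ-≤-nonNeg δ 0≤δ (ι-mono-≤ (m∸n≤m n (suc K))))) ⟩
        δn *ℚ ι (p * k * (B ∸ 1)) ∎
        where
        *-assoc-4 : ∀ a b c d → a * b * c * d ≡ a * (b * c * d)
        *-assoc-4 a b c d = trans (cong (_* d) (*-assoc a b c)) (*-assoc a (b * c) d)

    cliquesContaining≥ :
      ι (cliqueCount G (r ∸ k)) -ℚ ι (2 * k) *ℚ δ *ℚ ((n ^ (r ∸ k)) ÷! (r ∸ k)) *ℚ ι (r C suc K)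
        ≤ℚ ι (cliquesContaining G r e)
    cliquesContaining≥ rewrite r∸k≡1+m | sym (binomial≡C r (suc K)) = x≤y+z⇒x-z≤y {ι cc} slack (ι-cancelʳ-≤ {ι cc} P (*-mono-≤ (1≤n! (suc m)) 1≤n) (begin
      ι cc *ℚ ι P
        ≡⟨ ι-* cc P ⟨
      ι (cc * P)
        ≤⟨ ι-mono-≤ (cliqueCount-gap G e e∈G maxMissing missing≤maxMissing r m r∸k≡1+m k≤r) ⟩
      ι (κ * P + (A₁ + A₂))
        ≡⟨ trans (ι-+ (κ * P) (A₁ + A₂)) (cong (_+ℚ ι (A₁ + A₂)) (ι-* κ P)) ⟩
      ι κ *ℚ ι P +ℚ ι (A₁ + A₂)
        ≤⟨ ℚ.+-monoʳ-≤ (ι κ *ℚ ι P) error≤ ⟩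
      ι κ *ℚ ι P +ℚ δ *ℚ ι n *ℚ ι (p * k * (2 * Cr))
        ≡⟨ cong₂ (λ a b → ι κ *ℚ a +ℚ δ *ℚ ι n *ℚ b) (ι-* (suc m !) n) expand ⟩
      ι κ *ℚ (ι (suc m !) *ℚ ι n) +ℚ δ *ℚ ι n *ℚ (X *ℚ ι (suc m !) *ℚ ι k *ℚ (ι 2 *ℚ ι Cr))
        ≡⟨ solve 8 (λ c f x d y i t b → c :* (f :* x) :+ d :* x :* (y :* f :* i :* (t :* b))
                                       := (c :+ t :* i :* d :* y :* b) :* (f :* x))
                   refl (ι κ) (ι (suc m !)) (ι n) δ X (ι k) (ι 2) (ι Cr) ⟩
      (ι κ +ℚ ι 2 *ℚ ι k *ℚ δ *ℚ X *ℚ ι Cr) *ℚ (ι (suc m !) *ℚ ι n)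
        ≡⟨ cong₂ (λ a b → (ι κ +ℚ a *ℚ δ *ℚ X *ℚ ι Cr) *ℚ b) (ι-* 2 k) (ι-* (suc m !) n) ⟨
      (ι κ +ℚ slack) *ℚ ι P ∎))
      where
      open ℚ.≤-Reasoning
      open ℚ-Solver.+-*-Solver
      cc = cliqueCount G (suc m)
      κ = cliquesContaining G r e
      X = p ÷! suc m
      slack = ι (2 * k) *ℚ δ *ℚ X *ℚ ι Cr
      expand : ι (p * k * (2 * Cr)) ≡ X *ℚ ι (suc m !) *ℚ ι k *ℚ (ι 2 *ℚ ι Cr)
      expand = trans (ι-* (p * k) (2 * Cr))
                     (cong₂ _*ℚ_ (trans (ι-* p k) (cong (_*ℚ ι k) (sym (÷!*! p (suc m))))) (ι-* 2 Cr))

  bounds : ∀ r → k < r → Bounds ι _÷!_ G r δ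
  bounds r k<r =
    ( cliqueCount≥ r (<⇒≤ k<r)
    , subst (cliqueCount G r ≤_) (binomial≡C n r) (cliqueCount≤binomial r)
    , C≤^÷! n r )
    , λ e e∈G → cliquesContaining≥ e e∈G r k<r , cliquesContaining≤cliqueCount G e e∈G r

proposition3p2 : (n r k : ℕ) → 2 ≤ k → k < r → r < n →
    (δ : ℚ) → 1ℚ <ℚ ℕ→ℚ n *ℚ δ → δ <ℚ 1ℚ →
    (G : Hypergraph k n) →
    (∀ (S : Subset n) → ∣ S ∣ ≡ k ∸ 1 → (1ℚ -ℚ δ) *ℚ ℕ→ℚ n ≤ℚ ℕ→ℚ (codegree G S)) →
    ((1ℚ -ℚ ℕ→ℚ (r C k) *ℚ δ) *ℚ ℕ→ℚ (n C r) ≤ℚ ℕ→ℚ (cliqueCount G r)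
      × cliqueCount G r ≤ n C r
      × ℕ→ℚ (n C r) ≤ℚ (n ^ r) /! r)
    × (∀ (e : Subset n) → isEdge G e ≡ true →
        (ℕ→ℚ (cliqueCount G (r ∸ k))
           -ℚ ℕ→ℚ (2 * k) *ℚ δ *ℚ ((n ^ (r ∸ k)) /! (r ∸ k)) *ℚ ℕ→ℚ (r C (k ∸ 1))
           ≤ℚ ℕ→ℚ (cliquesContaining G r e))
        × cliquesContaining G r e ≤ cliqueCount G (r ∸ k))
proposition3p2 n r (suc (suc K)) (s≤s (s≤s z≤n)) k<r _ δ 1<nδ δ<1 G codegree≥ =
  subst₂ (λ ι′ ÷′ → Bounds ι′ ÷′ G r δ) ι≡ℕ→ℚ ÷!≡/! (bounds G δ 1<nδ′ δ<1 codegree≥′ r k<r)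
  where
  1<nδ′ = subst (λ ι′ → 1ℚ <ℚ ι′ n *ℚ δ) (sym ι≡ℕ→ℚ) 1<nδ
  codegree≥′ = subst (λ ι′ → ∀ S → ∣ S ∣ ≡ suc K → (1ℚ -ℚ δ) *ℚ ι′ n ≤ℚ ι′ (codegree G S)) (sym ι≡ℕ→ℚ) codegree≥
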